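{- Let $f:\{0,1\}^n\to\{0,1\}$ be a Boolean function computed by a minimal read-$k$ DNF formula with size $\alpha$ and maximum width $\beta$. Then \[ \mathsf{N}(\overline f)\ge\Omega\!\left(\sqrt{\frac{\alpha}{k\beta}}\right). \]
   Context: A DNF formula is an OR of terms, each an AND of literals; it is read-$k$ if every variable appears in at most $k$ terms. Its size is the number of terms, and the width of a term is its number of literals. A minimal DNF is one from which no term or literal can be removed without changing the computed function. $\mathsf{N}(g)$ is the minimum degree of a real polynomial $p$ with $|p(x)|\le 1/3$ whenever $g(x)=0$ and $|p(x)|\ge 1$ whenever $g(x)=1$; $\overline f=1-f$. The $\Omega(\cdot)$ hides an absolute positive constant.
   Formalization: The polynomials p in the definition of $\mathsf{N}(\overline f)$ have rational coefficients rather than real ones. -}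

module Defs where

open import Data.Nat using (ℕ; zero; suc; _+_; _⊔_; _≤_)
open import Data.Bool using (Bool; true; false; _∧_; _∨_; not; if_then_else_)
open import Data.Fin using (Fin)
open import Data.Fin.Properties using (_≟_)
open import Data.Product using (_×_; _,_; proj₁; proj₂; Σ)
open import Data.List using (List; []; _∷_; length; map; foldr; filter; lookup; _[_]∷=_; removeAt)
open import Data.Bool.ListAction using (all; any)
open import Relation.Nullary.Decidable using (T?)
open import Data.Vec using (Vec)
import Data.Vec as V
open import Data.Integer using (+_)
open import Data.Rational as Q using (ℚ; 0ℚ; 1ℚ)
open import Relation.Nullary using (¬_; does)
open import Relation.Binary.PropositionalEquality using (_≡_)

-- Boolean inputs x ∈ {0,1}^n (true = 1)
Input : ℕ → Set
Input n = Fin n → Bool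

-- A literal: variable index together with its polarity (true = x_i, false = ¬x_i)
Literal : ℕ → Set
Literal n = Fin n × Bool

Term : ℕ → Set
Term n = List (Literal n)

DNF : ℕ → Set
DNF n = List (Term n)

evalLit : ∀ {n} → Literal n → Input n → Bool
evalLit (i , true) x = x i
evalLit (i , false) x = not (x i)

evalTerm : ∀ {n} → Term n → Input n → Bool
evalTerm t x = all (λ l → evalLit l x) t

evalDNF : ∀ {n} → DNF n → Input n → Bool
evalDNF F x = any (λ t → evalTerm t x) F

size : ∀ {n} → DNF n → ℕ
size F = length F

maxWidth : ∀ {n} → DNF n → ℕ
maxWidth F = foldr (λ t m → length t ⊔ m) 0 F

occurs : ∀ {n} → Fin n → Term n → Bool
occurs i t = any (λ l → does (i ≟ proj₁ l)) t

ReadK : ∀ {n} → ℕ → DNF n → Set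
ReadK {n} k F = (i : Fin n) → length (filter (λ t → T? (occurs i t)) F) ≤ k

SameFunction : ∀ {n} → DNF n → DNF n → Set
SameFunction F G = ∀ x → evalDNF F x ≡ evalDNF G x

Minimal : ∀ {n} → DNF n → Set
Minimal F =
  ((j : Fin (length F)) → ¬ SameFunction (removeAt F j) F) ×
  ((j : Fin (length F)) (l : Fin (length (lookup F j))) →
     ¬ SameFunction (F [ j ]∷= removeAt (lookup F j) l) F)

-- Real polynomials in n variables, represented with rational coefficients as a finite list of monomials: coefficient and exponent vector.
Monomial : ℕ → Set
Monomial n = ℚ × Vec ℕ n

Poly : ℕ → Set
Poly n = List (Monomial n)

-- degree of the representation: maximum total degree of the listed monomials
degree : ∀ {n} → Poly n → ℕ
degree p = foldr (λ m d → V.foldr _ _+_ 0 (proj₂ m) ⊔ d) 0 p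

bitℚ : Bool → ℚ
bitℚ true = 1ℚ
bitℚ false = 0ℚ

powℚ : ℚ → ℕ → ℚ
powℚ q zero = 1ℚ
powℚ q (suc e) = q Q.* powℚ q e

evalMono : ∀ {n} → Monomial n → Input n → ℚ
evalMono (c , es) x =
  c Q.* V.foldr _ Q._*_ 1ℚ (V.zipWith (λ i e → powℚ (bitℚ (x i)) e) (V.allFin _) es)

evalPoly : ∀ {n} → Poly n → Input n → ℚ
evalPoly p x = foldr (λ m s → evalMono m x Q.+ s) 0ℚ p

oneThird : ℚ
oneThird = + 1 Q./ 3

NApprox : ∀ {n} → Poly n → (Input n → Bool) → Set
NApprox p g = ∀ x →
  (g x ≡ false → Q.∣ evalPoly p x ∣ Q.≤ oneThird) ×
  (g x ≡ true → 1ℚ Q.≤ Q.∣ evalPoly p x ∣)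

-- Pick a falsifying point x₀ of F (it exists by minimality, as F has a literal) and,
-- greedily, a maximal family S of pairwise variable-disjoint terms of F. Every term meets at most
-- w·k others (read-k), so size F ≤ w·k·|S|. Each term of S is satisfiable (minimality again), so
-- setting z ∈ {0,1}^S to "switch on" the chosen terms over x₀ gives a substitution under which
-- 1 - F becomes the indicator of z = 0; because the terms are disjoint, every input variable
-- depends on at most one bit of z, so p turns into a polynomial H of degree ≤ deg p with
-- |H 0| ≥ 1 and |H z| ≤ 1/3 for z ≠ 0. Such an H needs degree² ≥ |S|/200: averaging H under
-- the product measure with bias s gives a univariate P with P 0 = H 0 and
-- |P s| ≤ 1/3 + (1 - s)^|S| |P 0|, and if 200·deg² < |S| then Lagrange extrapolation of P to 0
-- from the nodes 5/|S| and 200j²/|S| (1 ≤ j ≤ deg) bounds |P 0| by a fraction κ < 1 of itself.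

module Submission where

module RationalFacts where

  open import Data.Nat as ℕ using (ℕ; zero; suc; s≤s; z≤n)
  import Data.Nat.Properties as ℕₚ
  open import Data.Rational
  open import Data.Rational.Properties
  open import Data.Rational.Solver using (module +-*-Solver)
  open import Data.Empty using (⊥-elim)
  open import Data.Sum using (_⊎_; inj₁; inj₂)
  open import Relation.Nullary using (Dec; yes; no)
  open import Relation.Nullary.Decidable using (toWitness)
  open import Relation.Binary.PropositionalEquality
  open +-*-Solver

  -- Junk value recip 0ℚ = 0ℚ; it keeps NonZero instances out of sums over nodes.
  recip : ℚ → ℚ
  recip p with p ≟ 0ℚ
  ... | yes _ = 0ℚ
  ... | no p≢0 = (1/ p) {{≢-nonZero p≢0}}

  recip-inverseˡ : ∀ p → p ≢ 0ℚ → recip p * p ≡ 1ℚ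
  recip-inverseˡ p p≢0 with p ≟ 0ℚ
  ... | yes p≡0 = ⊥-elim (p≢0 p≡0)
  ... | no p≢0′ = *-inverseˡ p {{≢-nonZero p≢0′}}

  recip-inverseʳ : ∀ p → p ≢ 0ℚ → p * recip p ≡ 1ℚ
  recip-inverseʳ p p≢0 = trans (*-comm p (recip p)) (recip-inverseˡ p p≢0)

  inverse-unique : ∀ {x y p} → x * p ≡ 1ℚ → y * p ≡ 1ℚ → x ≡ y
  inverse-unique {x} {y} {p} xp≡1 yp≡1 = begin
    x            ≡⟨ sym (*-identityʳ x) ⟩
    x * 1ℚ       ≡⟨ cong (x *_) (sym yp≡1) ⟩
    x * (y * p)  ≡⟨ solve 3 (λ x y p → x :* (y :* p) := (x :* p) :* y) refl x y p ⟩
    (x * p) * y  ≡⟨ cong (_* y) xp≡1 ⟩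
    1ℚ * y       ≡⟨ *-identityˡ y ⟩
    y            ∎
    where open ≡-Reasoning

  *-≢0 : ∀ {p q} → p ≢ 0ℚ → q ≢ 0ℚ → p * q ≢ 0ℚ
  *-≢0 {p} {q} p≢0 q≢0 pq≡0 = q≢0 (begin
    q                    ≡⟨ sym (*-identityˡ q) ⟩
    1ℚ * q               ≡⟨ cong (_* q) (sym (recip-inverseˡ p p≢0)) ⟩
    (recip p * p) * q    ≡⟨ *-assoc (recip p) p q ⟩
    recip p * (p * q)    ≡⟨ cong (recip p *_) pq≡0 ⟩
    recip p * 0ℚ         ≡⟨ *-zeroʳ (recip p) ⟩
    0ℚ                   ∎)
    where open ≡-Reasoning

  *≡0⇒ : ∀ {p q} → p * q ≡ 0ℚ → p ≡ 0ℚ ⊎ q ≡ 0ℚ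
  *≡0⇒ {p} {q} pq≡0 with p ≟ 0ℚ | q ≟ 0ℚ
  ... | yes p≡0 | _       = inj₁ p≡0
  ... | no _    | yes q≡0 = inj₂ q≡0
  ... | no p≢0  | no q≢0  = ⊥-elim (*-≢0 p≢0 q≢0 pq≡0)

  recip-* : ∀ p q → recip (p * q) ≡ recip p * recip q
  recip-* p q = by-cases (p ≟ 0ℚ) (q ≟ 0ℚ)
    where
    open ≡-Reasoning
    by-cases : Dec (p ≡ 0ℚ) → Dec (q ≡ 0ℚ) → recip (p * q) ≡ recip p * recip q
    by-cases (yes refl) _ = trans (cong recip (*-zeroˡ q)) (sym (*-zeroˡ (recip q)))
    by-cases (no _) (yes refl) = trans (cong recip (*-zeroʳ p)) (sym (*-zeroʳ (recip p)))
    by-cases (no p≢0) (no q≢0) = inverse-unique (recip-inverseˡ (p * q) (*-≢0 p≢0 q≢0)) (begin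
      recip p * recip q * (p * q)    ≡⟨ solve 4 (λ x y a b → x :* y :* (a :* b) := (x :* a) :* (y :* b)) refl (recip p) (recip q) p q ⟩
      (recip p * p) * (recip q * q)  ≡⟨ cong₂ _*_ (recip-inverseˡ p p≢0) (recip-inverseˡ q q≢0) ⟩
      1ℚ                             ∎)

  recip-∣∣ : ∀ p → recip ∣ p ∣ ≡ ∣ recip p ∣
  recip-∣∣ p = by-cases (p ≟ 0ℚ)
    where
    by-cases : Dec (p ≡ 0ℚ) → recip ∣ p ∣ ≡ ∣ recip p ∣
    by-cases (yes refl) = refl
    by-cases (no p≢0) = inverse-unique
      (recip-inverseˡ ∣ p ∣ (λ ∣p∣≡0 → p≢0 (∣p∣≡0⇒p≡0 p ∣p∣≡0)))
      (trans (sym (∣p*q∣≡∣p∣*∣q∣ (recip p) p)) (cong ∣_∣ (recip-inverseˡ p p≢0)))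

  recip-nonNeg : ∀ {p} → 0ℚ ≤ p → 0ℚ ≤ recip p
  recip-nonNeg {p} 0≤p = subst (λ q → 0ℚ ≤ recip q) (0≤p⇒∣p∣≡p 0≤p)
    (subst (0ℚ ≤_) (sym (recip-∣∣ p)) (0≤∣p∣ (recip p)))

  *-monoˡ-≤-0≤ : ∀ {r p q} → 0ℚ ≤ r → p ≤ q → r * p ≤ r * q
  *-monoˡ-≤-0≤ {r} 0≤r = *-monoˡ-≤-nonNeg r {{nonNegative 0≤r}}

  *-monoʳ-≤-0≤ : ∀ {r p q} → 0ℚ ≤ r → p ≤ q → p * r ≤ q * r
  *-monoʳ-≤-0≤ {r} 0≤r = *-monoʳ-≤-nonNeg r {{nonNegative 0≤r}}

  *-mono-≤-0≤ : ∀ {a b c d} → 0ℚ ≤ a → 0ℚ ≤ c → a ≤ b → c ≤ d → a * c ≤ b * d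
  *-mono-≤-0≤ 0≤a 0≤c a≤b c≤d = ≤-trans (*-monoˡ-≤-0≤ 0≤a c≤d) (*-monoʳ-≤-0≤ (≤-trans 0≤c c≤d) a≤b)

  0≤* : ∀ {p q} → 0ℚ ≤ p → 0ℚ ≤ q → 0ℚ ≤ p * q
  0≤* {p} {q} 0≤p 0≤q = subst (_≤ p * q) (*-zeroˡ q) (*-monoʳ-≤-0≤ 0≤q 0≤p)

  0≤1 : 0ℚ ≤ 1ℚ
  0≤1 = toWitness {a? = 0ℚ ≤? 1ℚ} _

  0<1 : 0ℚ < 1ℚ
  0<1 = toWitness {a? = 0ℚ <? 1ℚ} _

  0<⇒≢0 : ∀ {p} → 0ℚ < p → p ≢ 0ℚ
  0<⇒≢0 0<p p≡0 = <⇒≢ 0<p (sym p≡0)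

  recip-pos : ∀ {p} → 0ℚ < p → 0ℚ < recip p
  recip-pos {p} 0<p with recip p ≤? 0ℚ
  ... | no r≰0 = ≰⇒> r≰0
  ... | yes r≤0 = ⊥-elim (<-irrefl refl (<-≤-trans 0<1
    (subst (_≤ 0ℚ) (recip-inverseˡ p (0<⇒≢0 0<p))
      (subst (recip p * p ≤_) (*-zeroˡ p) (*-monoʳ-≤-0≤ (<⇒≤ 0<p) r≤0)))))

  0≤q-p : ∀ {p q} → p ≤ q → 0ℚ ≤ q - p
  0≤q-p {p} {q} le = subst (_≤ q - p) (+-inverseʳ p) (+-monoˡ-≤ (- p) le)

  p-q≤p : ∀ {p q} → 0ℚ ≤ q → p - q ≤ p
  p-q≤p {p} {q} 0≤q = subst (p - q ≤_) (+-identityʳ p) (+-monoʳ-≤ p (neg-antimono-≤ 0≤q))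

  ≤-recip : ∀ {p q} → 0ℚ < q → p * q ≤ 1ℚ → p ≤ recip q
  ≤-recip {p} {q} 0<q pq≤1 = begin
    p                  ≡⟨ sym (*-identityʳ p) ⟩
    p * 1ℚ             ≡⟨ cong (p *_) (sym (recip-inverseʳ q (0<⇒≢0 0<q))) ⟩
    p * (q * recip q)  ≡⟨ sym (*-assoc p q (recip q)) ⟩
    (p * q) * recip q  ≤⟨ *-monoʳ-≤-0≤ (recip-nonNeg (<⇒≤ 0<q)) pq≤1 ⟩
    1ℚ * recip q       ≡⟨ *-identityˡ (recip q) ⟩
    recip q            ∎
    where open ≤-Reasoning

  ι : ℕ → ℚ
  ι zero = 0ℚ
  ι (suc n) = 1ℚ + ι n

  infixl 8 _/ℕ_
  _/ℕ_ : ℕ → ℕ → ℚ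
  a /ℕ b = ι a * recip (ι b)

  ι-+ : ∀ a b → ι (a ℕ.+ b) ≡ ι a + ι b
  ι-+ zero b = sym (+-identityˡ (ι b))
  ι-+ (suc a) b = trans (cong (1ℚ +_) (ι-+ a b)) (sym (+-assoc 1ℚ (ι a) (ι b)))

  ι-* : ∀ a b → ι (a ℕ.* b) ≡ ι a * ι b
  ι-* zero b = sym (*-zeroˡ (ι b))
  ι-* (suc a) b = trans (ι-+ b (a ℕ.* b)) (trans (cong (ι b +_) (ι-* a b))
    (solve 2 (λ a b → b :+ a :* b := (con 1ℚ :+ a) :* b) refl (ι a) (ι b)))

  ι-nonNeg : ∀ n → 0ℚ ≤ ι n
  ι-nonNeg zero = ≤-refl
  ι-nonNeg (suc n) = subst (_≤ 1ℚ + ι n) (+-identityʳ 0ℚ) (+-mono-≤ 0≤1 (ι-nonNeg n))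

  ι-pos : ∀ n → 0ℚ < ι (suc n)
  ι-pos n = subst (_< 1ℚ + ι n) (+-identityʳ 0ℚ) (+-mono-<-≤ 0<1 (ι-nonNeg n))

  ι-suc≢0 : ∀ n → ι (suc n) ≢ 0ℚ
  ι-suc≢0 n = 0<⇒≢0 (ι-pos n)

  ι-mono-≤ : ∀ {a b} → a ℕ.≤ b → ι a ≤ ι b
  ι-mono-≤ {zero} {b} z≤n = ι-nonNeg b
  ι-mono-≤ (s≤s a≤b) = +-monoʳ-≤ 1ℚ (ι-mono-≤ a≤b)

  ι-mono-< : ∀ {a b} → a ℕ.< b → ι a < ι b
  ι-mono-< {zero} {suc b} _ = ι-pos b
  ι-mono-< {suc a} {suc b} (s≤s a<b) = +-monoʳ-< 1ℚ (ι-mono-< a<b)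

  ι-∣-∣ : ∀ a b → ∣ ι a - ι b ∣ ≡ ι ℕ.∣ a - b ∣
  ι-∣-∣ zero b = trans (cong ∣_∣ (+-identityˡ (- ι b))) (trans (∣-p∣≡∣p∣ (ι b)) (0≤p⇒∣p∣≡p (ι-nonNeg b)))
  ι-∣-∣ (suc a) zero = trans (cong ∣_∣ (+-identityʳ (ι (suc a)))) (0≤p⇒∣p∣≡p (ι-nonNeg (suc a)))
  ι-∣-∣ (suc a) (suc b) = trans
    (cong ∣_∣ (solve 3 (λ o a b → (o :+ a) :- (o :+ b) := a :- b) refl 1ℚ (ι a) (ι b))) (ι-∣-∣ a b)

  /ℕ-nonNeg : ∀ a b → 0ℚ ≤ a /ℕ b
  /ℕ-nonNeg a b = 0≤* (ι-nonNeg a) (recip-nonNeg (ι-nonNeg b))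

  /ℕ-mono-≤ : ∀ a b c d → 0 ℕ.< b → 0 ℕ.< d → a ℕ.* d ℕ.≤ c ℕ.* b → a /ℕ b ≤ c /ℕ d
  /ℕ-mono-≤ a (suc b) c (suc d) _ _ ad≤cb = begin
    ι a * b⁻¹                     ≡⟨ sym (*-identityʳ _) ⟩
    ι a * b⁻¹ * 1ℚ                ≡⟨ cong (ι a * b⁻¹ *_) (sym (recip-inverseʳ (ι (suc d)) (ι-suc≢0 d))) ⟩
    ι a * b⁻¹ * (ι (suc d) * d⁻¹) ≡⟨ solve 4 (λ a b⁻¹ d d⁻¹ → a :* b⁻¹ :* (d :* d⁻¹) := (a :* d) :* (b⁻¹ :* d⁻¹)) refl (ι a) b⁻¹ (ι (suc d)) d⁻¹ ⟩
    ι a * ι (suc d) * (b⁻¹ * d⁻¹) ≡⟨ cong (_* (b⁻¹ * d⁻¹)) (sym (ι-* a (suc d))) ⟩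
    ι (a ℕ.* suc d) * (b⁻¹ * d⁻¹) ≤⟨ *-monoʳ-≤-0≤ (0≤* (recip-nonNeg (ι-nonNeg (suc b))) (recip-nonNeg (ι-nonNeg (suc d)))) (ι-mono-≤ ad≤cb) ⟩
    ι (c ℕ.* suc b) * (b⁻¹ * d⁻¹) ≡⟨ cong (_* (b⁻¹ * d⁻¹)) (ι-* c (suc b)) ⟩
    ι c * ι (suc b) * (b⁻¹ * d⁻¹) ≡⟨ solve 4 (λ c b b⁻¹ d⁻¹ → (c :* b) :* (b⁻¹ :* d⁻¹) := (c :* d⁻¹) :* (b :* b⁻¹)) refl (ι c) (ι (suc b)) b⁻¹ d⁻¹ ⟩
    ι c * d⁻¹ * (ι (suc b) * b⁻¹) ≡⟨ cong (ι c * d⁻¹ *_) (recip-inverseʳ (ι (suc b)) (ι-suc≢0 b)) ⟩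
    ι c * d⁻¹ * 1ℚ                ≡⟨ *-identityʳ _ ⟩
    ι c * d⁻¹                     ∎
    where
    open ≤-Reasoning
    b⁻¹ : ℚ
    b⁻¹ = recip (ι (suc b))
    d⁻¹ : ℚ
    d⁻¹ = recip (ι (suc d))

  /ℕ-≤1 : ∀ a b → 0 ℕ.< b → a ℕ.≤ b → a /ℕ b ≤ 1ℚ
  /ℕ-≤1 a b 0<b a≤b = /ℕ-mono-≤ a b 1 1 0<b (s≤s z≤n)
    (subst₂ ℕ._≤_ (sym (ℕₚ.*-identityʳ a)) (sym (ℕₚ.*-identityˡ b)) a≤b)

  /ℕ-+ : ∀ a b c d → 0 ℕ.< b → 0 ℕ.< d → a /ℕ b + c /ℕ d ≡ (a ℕ.* d ℕ.+ c ℕ.* b) /ℕ (b ℕ.* d)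
  /ℕ-+ a (suc b) c (suc d) _ _ = sym (begin
    ι (a ℕ.* suc d ℕ.+ c ℕ.* suc b) * recip (ι (suc b ℕ.* suc d))
      ≡⟨ cong₂ _*_ (trans (ι-+ (a ℕ.* suc d) (c ℕ.* suc b)) (cong₂ _+_ (ι-* a (suc d)) (ι-* c (suc b))))
                   (trans (cong recip (ι-* (suc b) (suc d))) (recip-* B D)) ⟩
    (ι a * D + ι c * B) * (b⁻¹ * d⁻¹)
      ≡⟨ solve 6 (λ a d c b b⁻¹ d⁻¹ → (a :* d :+ c :* b) :* (b⁻¹ :* d⁻¹) := a :* b⁻¹ :* (d :* d⁻¹) :+ c :* d⁻¹ :* (b :* b⁻¹))
           refl (ι a) D (ι c) B b⁻¹ d⁻¹ ⟩
    ι a * b⁻¹ * (D * d⁻¹) + ι c * d⁻¹ * (B * b⁻¹)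
      ≡⟨ cong₂ (λ x y → ι a * b⁻¹ * x + ι c * d⁻¹ * y) (recip-inverseʳ D (ι-suc≢0 d)) (recip-inverseʳ B (ι-suc≢0 b)) ⟩
    ι a * b⁻¹ * 1ℚ + ι c * d⁻¹ * 1ℚ
      ≡⟨ cong₂ _+_ (*-identityʳ (ι a * b⁻¹)) (*-identityʳ (ι c * d⁻¹)) ⟩
    ι a * b⁻¹ + ι c * d⁻¹ ∎)
    where
    open ≡-Reasoning
    B : ℚ
    B = ι (suc b)
    D : ℚ
    D = ι (suc d)
    b⁻¹ : ℚ
    b⁻¹ = recip B
    d⁻¹ : ℚ
    d⁻¹ = recip D


module FiniteSums where

  open import Data.Nat as ℕ using (ℕ)
  open import Data.Rational
  open import Data.Rational.Properties
  open import Data.Rational.Solver using (module +-*-Solver)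
  open import Data.List using (List; []; _∷_; map)
  open import Data.Nat.ListAction using (product)
  open import Data.List.Properties using (map-∘)
  open import Data.List.Relation.Unary.All using (All; []; _∷_)
  open import Data.Product using (_×_; _,_; proj₁; proj₂; map₂)
  open import Relation.Binary.PropositionalEquality
  open +-*-Solver
  open RationalFacts

  private variable A B : Set

  ∑ : (A → ℚ) → List A → ℚ
  ∑ f [] = 0ℚ
  ∑ f (x ∷ xs) = f x + ∑ f xs

  ∏ : (A → ℚ) → List A → ℚ
  ∏ f [] = 1ℚ
  ∏ f (x ∷ xs) = f x * ∏ f xs

  ∑-cong : ∀ {f g : A → ℚ} xs → (∀ x → f x ≡ g x) → ∑ f xs ≡ ∑ g xs
  ∑-cong [] f≗g = refl
  ∑-cong (x ∷ xs) f≗g = cong₂ _+_ (f≗g x) (∑-cong xs f≗g)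

  ∑-congᴬ : ∀ {f g : A → ℚ} {xs} → All (λ x → f x ≡ g x) xs → ∑ f xs ≡ ∑ g xs
  ∑-congᴬ [] = refl
  ∑-congᴬ (e ∷ es) = cong₂ _+_ e (∑-congᴬ es)

  ∑-map : ∀ (f : B → ℚ) (g : A → B) xs → ∑ f (map g xs) ≡ ∑ (λ x → f (g x)) xs
  ∑-map f g [] = refl
  ∑-map f g (x ∷ xs) = cong (f (g x) +_) (∑-map f g xs)

  ∑-+ : ∀ (f g : A → ℚ) xs → ∑ (λ x → f x + g x) xs ≡ ∑ f xs + ∑ g xs
  ∑-+ f g [] = refl
  ∑-+ f g (x ∷ xs) = trans (cong (f x + g x +_) (∑-+ f g xs))
    (solve 4 (λ a b c d → a :+ b :+ (c :+ d) := a :+ c :+ (b :+ d)) refl (f x) (g x) (∑ f xs) (∑ g xs))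

  ∑-*ˡ : ∀ c (f : A → ℚ) xs → ∑ (λ x → c * f x) xs ≡ c * ∑ f xs
  ∑-*ˡ c f [] = sym (*-zeroʳ c)
  ∑-*ˡ c f (x ∷ xs) = trans (cong (c * f x +_) (∑-*ˡ c f xs)) (sym (*-distribˡ-+ c (f x) (∑ f xs)))

  ∑-monoᴬ : ∀ {f g : A → ℚ} {xs} → All (λ x → f x ≤ g x) xs → ∑ f xs ≤ ∑ g xs
  ∑-monoᴬ [] = ≤-refl
  ∑-monoᴬ (le ∷ les) = +-mono-≤ le (∑-monoᴬ les)

  ∑-nonNeg : ∀ (f : A → ℚ) xs → (∀ x → 0ℚ ≤ f x) → 0ℚ ≤ ∑ f xs
  ∑-nonNeg f [] _ = ≤-refl
  ∑-nonNeg f (x ∷ xs) 0≤f = subst (_≤ f x + ∑ f xs) (+-identityʳ 0ℚ) (+-mono-≤ (0≤f x) (∑-nonNeg f xs 0≤f))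

  ∣∑∣≤∑∣∣ : ∀ (f : A → ℚ) xs → ∣ ∑ f xs ∣ ≤ ∑ (λ x → ∣ f x ∣) xs
  ∣∑∣≤∑∣∣ f [] = ≤-refl
  ∣∑∣≤∑∣∣ f (x ∷ xs) = ≤-trans (∣p+q∣≤∣p∣+∣q∣ (f x) (∑ f xs)) (+-monoʳ-≤ ∣ f x ∣ (∣∑∣≤∑∣∣ f xs))

  ∏-cong : ∀ {f g : A → ℚ} xs → (∀ x → f x ≡ g x) → ∏ f xs ≡ ∏ g xs
  ∏-cong [] f≗g = refl
  ∏-cong (x ∷ xs) f≗g = cong₂ _*_ (f≗g x) (∏-cong xs f≗g)

  ∏-nonNeg : ∀ (f : A → ℚ) xs → (∀ x → 0ℚ ≤ f x) → 0ℚ ≤ ∏ f xs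
  ∏-nonNeg f [] _ = 0≤1
  ∏-nonNeg f (x ∷ xs) 0≤f = 0≤* (0≤f x) (∏-nonNeg f xs 0≤f)

  ∏-/ℕ : ∀ (f g : A → ℕ) xs → ∏ (λ x → f x /ℕ g x) xs ≡ product (map f xs) /ℕ product (map g xs)
  ∏-/ℕ f g [] = refl
  ∏-/ℕ f g (x ∷ xs) = begin
    f x /ℕ g x * ∏ (λ x → f x /ℕ g x) xs              ≡⟨ cong (f x /ℕ g x *_) (∏-/ℕ f g xs) ⟩
    ι (f x) * recip (ι (g x)) * (ι F * recip (ι G))     ≡⟨ solve 4 (λ a b c d → a :* b :* (c :* d) := (a :* c) :* (b :* d)) refl (ι (f x)) (recip (ι (g x))) (ι F) (recip (ι G)) ⟩
    (ι (f x) * ι F) * (recip (ι (g x)) * recip (ι G))   ≡⟨ cong₂ _*_ (sym (ι-* (f x) F)) (sym (recip-* (ι (g x)) (ι G))) ⟩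
    ι (f x ℕ.* F) * recip (ι (g x) * ι G)               ≡⟨ cong (λ z → ι (f x ℕ.* F) * recip z) (sym (ι-* (g x) G)) ⟩
    (f x ℕ.* F) /ℕ (g x ℕ.* G)                         ∎
    where
    open ≡-Reasoning
    F : ℕ
    F = product (map f xs)
    G : ℕ
    G = product (map g xs)

  select : List A → List (A × List A)
  select [] = []
  select (x ∷ xs) = (x , xs) ∷ map (map₂ (x ∷_)) (select xs)

  All-select : ∀ {P : A → Set} {xs} → All P xs → All (λ p → P (proj₁ p)) (select xs)
  All-select [] = []
  All-select {P = P} {x ∷ xs} (px ∷ pxs) = px ∷ shift (All-select pxs)
    where
    shift : ∀ {ps} → All (λ p → P (proj₁ p)) ps → All (λ p → P (proj₁ p)) (map (map₂ (x ∷_)) ps)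
    shift [] = []
    shift (a ∷ as) = a ∷ shift as

  ∑-select : ∀ (f : A → ℚ) xs → ∑ (λ p → f (proj₁ p)) (select xs) ≡ ∑ f xs
  ∑-select f [] = refl
  ∑-select f (x ∷ xs) = cong (f x +_) (trans (∑-map (λ p → f (proj₁ p)) (map₂ (x ∷_)) (select xs)) (∑-select f xs))

  select-map : ∀ (h : A → B) xs → select (map h xs) ≡ map (λ p → h (proj₁ p) , map h (proj₂ p)) (select xs)
  select-map h [] = refl
  select-map h (x ∷ xs) = cong ((h x , map h xs) ∷_)
    (trans (cong (map (map₂ (h x ∷_))) (select-map h xs)) (trans (sym (map-∘ (select xs))) (map-∘ (select xs))))


module DividedDifferences where

  open import Data.Nat as ℕ using (ℕ; suc; s≤s)
  import Data.Nat.Properties as ℕₚ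
  open import Data.Rational
  open import Data.Rational.Properties
  open import Data.Rational.Solver using (module +-*-Solver)
  open import Data.List using (List; []; _∷_; map; length)
  open import Data.List.Relation.Unary.All using (All; []; _∷_)
  open import Data.List.Relation.Unary.AllPairs using ([]; _∷_)
  open import Data.List.Relation.Unary.Unique.Propositional using (Unique)
  open import Data.Product using (_×_; _,_; proj₁; proj₂; map₂)
  open import Data.Sum using (_⊎_; inj₁; inj₂)
  open import Data.Empty using (⊥-elim)
  open import Function using (_∘_; id)
  open import Relation.Binary.PropositionalEquality
  open +-*-Solver
  open RationalFacts
  open FiniteSums

  divDiffTerm : (ℚ → ℚ) → ℚ × List ℚ → ℚ
  divDiffTerm f (x , others) = f x * recip (∏ (_-_ x) others)

  divDiff : List ℚ → (ℚ → ℚ) → ℚ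
  divDiff S f = ∑ (divDiffTerm f) (select S)

  data Degree≤ : ℕ → (ℚ → ℚ) → Set where
    constant : ∀ {D f} c → (∀ s → f s ≡ c) → Degree≤ D f
    plus-x* : ∀ {D f} g k → Degree≤ (suc D) g → Degree≤ D k → (∀ s → f s ≡ g s + s * k s) → Degree≤ (suc D) f

  divDiff-cong : ∀ S {f g} → (∀ x → f x ≡ g x) → divDiff S f ≡ divDiff S g
  divDiff-cong S f≗g = ∑-cong (select S) (λ { (x , r) → cong (_* recip (∏ (_-_ x) r)) (f≗g x) })

  divDiff-+ : ∀ S f g → divDiff S (λ x → f x + g x) ≡ divDiff S f + divDiff S g
  divDiff-+ S f g = trans
    (∑-cong (select S) (λ { (x , r) → *-distribʳ-+ (recip (∏ (_-_ x) r)) (f x) (g x) }))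
    (∑-+ (divDiffTerm f) (divDiffTerm g) (select S))

  divDiff-*ˡ : ∀ S c f → divDiff S (λ x → c * f x) ≡ c * divDiff S f
  divDiff-*ˡ S c f = trans
    (∑-cong (select S) (λ { (x , r) → *-assoc c (f x) (recip (∏ (_-_ x) r)) }))
    (∑-*ˡ c (divDiffTerm f) (select S))

  x-x≢0 : ∀ {x y} → x ≢ y → x - y ≢ 0ℚ
  x-x≢0 {x} {y} x≢y x-y≡0 = x≢y (begin
    x             ≡⟨ solve 2 (λ x y → x := (x :- y) :+ y) refl x y ⟩
    (x - y) + y   ≡⟨ cong (_+ y) x-y≡0 ⟩
    0ℚ + y        ≡⟨ +-identityˡ y ⟩
    y             ∎)
    where open ≡-Reasoning

  -- The factor x - x₀ kills the term of x₀ and cancels against x - x₀ in every other denominator.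
  divDiff-shift : ∀ x₀ T k → All (x₀ ≢_) T → divDiff (x₀ ∷ T) (λ x → (x - x₀) * k x) ≡ divDiff T k
  divDiff-shift x₀ T k x₀∉T = begin
    divDiffTerm f (x₀ , T) + ∑ (divDiffTerm f) (map (map₂ (x₀ ∷_)) (select T))
      ≡⟨ cong₂ _+_ term₀≡0 (∑-map (divDiffTerm f) (map₂ (x₀ ∷_)) (select T)) ⟩
    0ℚ + ∑ (λ p → divDiffTerm f (map₂ (x₀ ∷_) p)) (select T)
      ≡⟨ +-identityˡ _ ⟩
    ∑ (λ p → divDiffTerm f (map₂ (x₀ ∷_) p)) (select T)
      ≡⟨ ∑-congᴬ (cancel (All-select {P = x₀ ≢_} x₀∉T)) ⟩
    ∑ (divDiffTerm k) (select T) ∎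
    where
    open ≡-Reasoning
    f : ℚ → ℚ
    f x = (x - x₀) * k x
    term₀≡0 : divDiffTerm f (x₀ , T) ≡ 0ℚ
    term₀≡0 = begin
      (x₀ - x₀) * k x₀ * recip (∏ (_-_ x₀) T) ≡⟨ cong (λ z → z * k x₀ * recip (∏ (_-_ x₀) T)) (+-inverseʳ x₀) ⟩
      0ℚ * k x₀ * recip (∏ (_-_ x₀) T)        ≡⟨ cong (_* recip (∏ (_-_ x₀) T)) (*-zeroˡ (k x₀)) ⟩
      0ℚ * recip (∏ (_-_ x₀) T)               ≡⟨ *-zeroˡ (recip (∏ (_-_ x₀) T)) ⟩
      0ℚ                                      ∎
    cancel₁ : ∀ x r → x₀ ≢ x → divDiffTerm f (x , x₀ ∷ r) ≡ divDiffTerm k (x , r)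
    cancel₁ x r x₀≢x = begin
      (x - x₀) * k x * recip ((x - x₀) * ∏ (_-_ x) r)
        ≡⟨ cong ((x - x₀) * k x *_) (recip-* (x - x₀) (∏ (_-_ x) r)) ⟩
      (x - x₀) * k x * (recip (x - x₀) * recip (∏ (_-_ x) r))
        ≡⟨ solve 4 (λ a b c d → a :* b :* (c :* d) := (a :* c) :* (b :* d)) refl (x - x₀) (k x) (recip (x - x₀)) (recip (∏ (_-_ x) r)) ⟩
      ((x - x₀) * recip (x - x₀)) * (k x * recip (∏ (_-_ x) r))
        ≡⟨ cong (_* (k x * recip (∏ (_-_ x) r))) (recip-inverseʳ (x - x₀) (x-x≢0 (x₀≢x ∘ sym))) ⟩
      1ℚ * (k x * recip (∏ (_-_ x) r))
        ≡⟨ *-identityˡ _ ⟩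
      k x * recip (∏ (_-_ x) r) ∎
    cancel : ∀ {ps} → All (λ p → x₀ ≢ proj₁ p) ps → All (λ p → divDiffTerm f (map₂ (x₀ ∷_) p) ≡ divDiffTerm k p) ps
    cancel [] = []
    cancel {(x , r) ∷ _} (x₀≢x ∷ rest) = cancel₁ x r x₀≢x ∷ cancel rest

  divDiff-swap : ∀ x₀ x₁ U f → divDiff (x₀ ∷ x₁ ∷ U) f ≡ divDiff (x₁ ∷ x₀ ∷ U) f
  divDiff-swap x₀ x₁ U f = begin
    A + (B + ∑ (divDiffTerm f) (map (map₂ (x₀ ∷_)) (map (map₂ (x₁ ∷_)) (select U))))
      ≡⟨ cong (λ z → A + (B + z)) (swap-rest (select U)) ⟩
    A + (B + ∑ (divDiffTerm f) (map (map₂ (x₁ ∷_)) (map (map₂ (x₀ ∷_)) (select U))))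
      ≡⟨ solve 3 (λ a b c → a :+ (b :+ c) := b :+ (a :+ c)) refl A B _ ⟩
    B + (A + ∑ (divDiffTerm f) (map (map₂ (x₁ ∷_)) (map (map₂ (x₀ ∷_)) (select U)))) ∎
    where
    open ≡-Reasoning
    A : ℚ
    A = divDiffTerm f (x₀ , x₁ ∷ U)
    B : ℚ
    B = divDiffTerm f (x₁ , x₀ ∷ U)
    swap-rest : ∀ ps → ∑ (divDiffTerm f) (map (map₂ (x₀ ∷_)) (map (map₂ (x₁ ∷_)) ps))
                     ≡ ∑ (divDiffTerm f) (map (map₂ (x₁ ∷_)) (map (map₂ (x₀ ∷_)) ps))
    swap-rest [] = refl
    swap-rest ((x , r) ∷ ps) = cong₂ _+_
      (cong (λ z → f x * recip z) (solve 3 (λ a b c → a :* (b :* c) := b :* (a :* c)) refl (x - x₀) (x - x₁) (∏ (_-_ x) r)))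
      (swap-rest ps)

  -- (x₁ - x₀)·[S]1 = [x₁ ∷ U]1 - [x₀ ∷ U]1 by two shifts, and the right side vanishes by recursion
  -- (for U = [] both terms are 1).
  divDiff-const-1 : ∀ x₀ x₁ U → Unique (x₀ ∷ x₁ ∷ U) → divDiff (x₀ ∷ x₁ ∷ U) (λ _ → 1ℚ) ≡ 0ℚ
  divDiff-const-1 x₀ x₁ U ((x₀≢x₁ ∷ x₀∉U) ∷ (x₁∉U ∷ uniqueU)) = cancel-factor (*≡0⇒ key)
    where
    open ≡-Reasoning
    S : List ℚ
    S = x₀ ∷ x₁ ∷ U
    one : ℚ → ℚ
    one _ = 1ℚ
    tails : ∀ U → All (x₀ ≢_) U → All (x₁ ≢_) U → Unique U →
            divDiff (x₁ ∷ U) one + - 1ℚ * divDiff (x₀ ∷ U) one ≡ 0ℚ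
    tails [] _ _ _ = refl
    tails (u ∷ U′) (a ∷ as) (b ∷ bs) (c ∷ cs) =
      cong₂ (λ p q → p + - 1ℚ * q) (divDiff-const-1 x₁ u U′ ((b ∷ bs) ∷ (c ∷ cs))) (divDiff-const-1 x₀ u U′ ((a ∷ as) ∷ (c ∷ cs)))
    key : (x₁ - x₀) * divDiff S one ≡ 0ℚ
    key = begin
      (x₁ - x₀) * divDiff S one
        ≡⟨ sym (divDiff-*ˡ S (x₁ - x₀) one) ⟩
      divDiff S (λ x → (x₁ - x₀) * 1ℚ)
        ≡⟨ divDiff-cong S (λ x → solve 3 (λ x x₀ x₁ → (x₁ :- x₀) :* con 1ℚ := (x :- x₀) :* con 1ℚ :+ con (- 1ℚ) :* ((x :- x₁) :* con 1ℚ)) refl x x₀ x₁) ⟩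
      divDiff S (λ x → (x - x₀) * one x + - 1ℚ * ((x - x₁) * one x))
        ≡⟨ divDiff-+ S (λ x → (x - x₀) * one x) (λ x → - 1ℚ * ((x - x₁) * one x)) ⟩
      divDiff S (λ x → (x - x₀) * one x) + divDiff S (λ x → - 1ℚ * ((x - x₁) * one x))
        ≡⟨ cong₂ _+_ (divDiff-shift x₀ (x₁ ∷ U) one (x₀≢x₁ ∷ x₀∉U)) (divDiff-*ˡ S (- 1ℚ) (λ x → (x - x₁) * one x)) ⟩
      divDiff (x₁ ∷ U) one + - 1ℚ * divDiff S (λ x → (x - x₁) * one x)
        ≡⟨ cong (λ z → divDiff (x₁ ∷ U) one + - 1ℚ * z)
             (trans (divDiff-swap x₀ x₁ U (λ x → (x - x₁) * one x)) (divDiff-shift x₁ (x₀ ∷ U) one ((λ e → x₀≢x₁ (sym e)) ∷ x₁∉U))) ⟩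
      divDiff (x₁ ∷ U) one + - 1ℚ * divDiff (x₀ ∷ U) one
        ≡⟨ tails U x₀∉U x₁∉U uniqueU ⟩
      0ℚ ∎
    cancel-factor : x₁ - x₀ ≡ 0ℚ ⊎ divDiff S one ≡ 0ℚ → divDiff S one ≡ 0ℚ
    cancel-factor (inj₁ x₁-x₀≡0) = ⊥-elim (x-x≢0 (λ x₁≡x₀ → x₀≢x₁ (sym x₁≡x₀)) x₁-x₀≡0)
    cancel-factor (inj₂ dd≡0) = dd≡0

  divDiff-annihilates : ∀ {D f} → Degree≤ D f → ∀ S → Unique S → suc (suc D) ℕ.≤ length S → divDiff S f ≡ 0ℚ
  divDiff-annihilates {D} {f} (constant c f≗c) S@(x₀ ∷ x₁ ∷ U) unique _ = begin
    divDiff S f                  ≡⟨ divDiff-cong S (λ x → trans (f≗c x) (sym (*-identityʳ c))) ⟩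
    divDiff S (λ _ → c * 1ℚ)     ≡⟨ divDiff-*ˡ S c (λ _ → 1ℚ) ⟩
    c * divDiff S (λ _ → 1ℚ)     ≡⟨ cong (c *_) (divDiff-const-1 x₀ x₁ U unique) ⟩
    c * 0ℚ                       ≡⟨ *-zeroʳ c ⟩
    0ℚ                           ∎
    where open ≡-Reasoning
  divDiff-annihilates (constant c _) (_ ∷ []) _ (s≤s ())
  divDiff-annihilates {suc D} {f} (plus-x* g k deg-g deg-k f≗) S@(x₀ ∷ T) unique@(x₀∉T ∷ uniqueT) (s≤s D+1≤|T|) = begin
    divDiff S f
      ≡⟨ divDiff-cong S (λ x → trans (f≗ x) (solve 4 (λ g k x x₀ → g :+ x :* k := g :+ ((x :- x₀) :* k :+ x₀ :* k)) refl (g x) (k x) x x₀)) ⟩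
    divDiff S (λ x → g x + ((x - x₀) * k x + x₀ * k x))
      ≡⟨ divDiff-+ S g (λ x → (x - x₀) * k x + x₀ * k x) ⟩
    divDiff S g + divDiff S (λ x → (x - x₀) * k x + x₀ * k x)
      ≡⟨ cong (divDiff S g +_) (divDiff-+ S (λ x → (x - x₀) * k x) (λ x → x₀ * k x)) ⟩
    divDiff S g + (divDiff S (λ x → (x - x₀) * k x) + divDiff S (λ x → x₀ * k x))
      ≡⟨ cong₂ (λ a b → divDiff S g + (a + b)) (divDiff-shift x₀ T k x₀∉T) (divDiff-*ˡ S x₀ k) ⟩
    divDiff S g + (divDiff T k + x₀ * divDiff S k)
      ≡⟨ cong₂ (λ a b → a + (b + x₀ * divDiff S k))
           (divDiff-annihilates deg-g S unique (s≤s D+1≤|T|)) (divDiff-annihilates deg-k T uniqueT D+1≤|T|) ⟩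
    0ℚ + (0ℚ + x₀ * divDiff S k)
      ≡⟨ cong (λ z → 0ℚ + (0ℚ + x₀ * z)) (divDiff-annihilates deg-k S unique (ℕₚ.m≤n⇒m≤1+n D+1≤|T|)) ⟩
    0ℚ + (0ℚ + x₀ * 0ℚ)
      ≡⟨ cong (λ z → 0ℚ + (0ℚ + z)) (*-zeroʳ x₀) ⟩
    0ℚ ∎
    where open ≡-Reasoning

  -- |ℓₓ(0)| for the Lagrange basis polynomial ℓₓ of the node x among the nodes x ∷ others.
  lagrangeWeight : ℚ → List ℚ → ℚ
  lagrangeWeight x others = ∏ (λ y → ∣ y ∣ * recip ∣ x - y ∣) others

  ∏-0- : ∀ T → ∏ (_-_ 0ℚ) T ≡ ∏ (λ _ → - 1ℚ) T * ∏ id T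
  ∏-0- [] = refl
  ∏-0- (y ∷ T) = begin
    (0ℚ - y) * ∏ (_-_ 0ℚ) T                      ≡⟨ cong ((0ℚ - y) *_) (∏-0- T) ⟩
    (0ℚ - y) * (∏ (λ _ → - 1ℚ) T * ∏ id T)       ≡⟨ solve 3 (λ y s p → (con 0ℚ :- y) :* (s :* p) := (con (- 1ℚ) :* s) :* (y :* p)) refl y (∏ (λ _ → - 1ℚ) T) (∏ id T) ⟩
    - 1ℚ * ∏ (λ _ → - 1ℚ) T * (y * ∏ id T)       ∎
    where open ≡-Reasoning

  ∣∏-1∣≡1 : ∀ (T : List ℚ) → ∣ ∏ (λ _ → - 1ℚ) T ∣ ≡ 1ℚ
  ∣∏-1∣≡1 [] = refl
  ∣∏-1∣≡1 (y ∷ T) = trans (∣p*q∣≡∣p∣*∣q∣ (- 1ℚ) (∏ (λ _ → - 1ℚ) T)) (cong (1ℚ *_) (∣∏-1∣≡1 T))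

  ∏-≢0 : ∀ T → All (0ℚ ≢_) T → ∏ id T ≢ 0ℚ
  ∏-≢0 [] [] ()
  ∏-≢0 (y ∷ T) (0≢y ∷ 0∉T) = *-≢0 (0≢y ∘ sym) (∏-≢0 T 0∉T)

  ∏-select : ∀ T → All (λ p → ∏ id T ≡ proj₁ p * ∏ id (proj₂ p)) (select T)
  ∏-select [] = []
  ∏-select (y ∷ T) = refl ∷ shift (∏-select T)
    where
    shift : ∀ {ps} → All (λ p → ∏ id T ≡ proj₁ p * ∏ id (proj₂ p)) ps →
            All (λ p → ∏ id (y ∷ T) ≡ proj₁ p * ∏ id (proj₂ p)) (map (map₂ (y ∷_)) ps)
    shift [] = []
    shift {(x , r) ∷ _} (e ∷ es) = trans (cong (y *_) e)
      (solve 3 (λ y x p → y :* (x :* p) := x :* (y :* p)) refl y x (∏ id r)) ∷ shift es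

  ∣∏/∏∣≡lagrangeWeight : ∀ x r → ∣ ∏ id r * recip (∏ (_-_ x) r) ∣ ≡ lagrangeWeight x r
  ∣∏/∏∣≡lagrangeWeight x [] = refl
  ∣∏/∏∣≡lagrangeWeight x (y ∷ r) = begin
    ∣ y * ∏ id r * recip ((x - y) * ∏ (_-_ x) r) ∣
      ≡⟨ cong (λ z → ∣ y * ∏ id r * z ∣) (recip-* (x - y) (∏ (_-_ x) r)) ⟩
    ∣ y * ∏ id r * (recip (x - y) * recip (∏ (_-_ x) r)) ∣
      ≡⟨ cong ∣_∣ (solve 4 (λ a b c d → a :* b :* (c :* d) := (a :* c) :* (b :* d)) refl y (∏ id r) (recip (x - y)) (recip (∏ (_-_ x) r))) ⟩
    ∣ (y * recip (x - y)) * (∏ id r * recip (∏ (_-_ x) r)) ∣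
      ≡⟨ ∣p*q∣≡∣p∣*∣q∣ (y * recip (x - y)) _ ⟩
    ∣ y * recip (x - y) ∣ * ∣ ∏ id r * recip (∏ (_-_ x) r) ∣
      ≡⟨ cong₂ _*_ (∣p*q∣≡∣p∣*∣q∣ y (recip (x - y))) (∣∏/∏∣≡lagrangeWeight x r) ⟩
    ∣ y ∣ * ∣ recip (x - y) ∣ * lagrangeWeight x r
      ≡⟨ cong (λ z → ∣ y ∣ * z * lagrangeWeight x r) (sym (recip-∣∣ (x - y))) ⟩
    ∣ y ∣ * recip ∣ x - y ∣ * lagrangeWeight x r ∎
    where open ≡-Reasoning

  lagrangeTerm : (ℚ → ℚ) → ℚ × List ℚ → ℚ
  lagrangeTerm P (x , others) = P x * (∏ id others * recip (∏ (_-_ x) others))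

  ∏*divDiffTerm-0 : ∀ P T → All (0ℚ ≢_) T → ∏ id T * divDiffTerm P (0ℚ , T) ≡ P 0ℚ * recip (∏ (λ _ → - 1ℚ) T)
  ∏*divDiffTerm-0 P T 0∉T = begin
    Z * (P 0ℚ * recip (∏ (_-_ 0ℚ) T))    ≡⟨ cong (λ z → Z * (P 0ℚ * recip z)) (∏-0- T) ⟩
    Z * (P 0ℚ * recip (σ * Z))           ≡⟨ cong (λ z → Z * (P 0ℚ * z)) (recip-* σ Z) ⟩
    Z * (P 0ℚ * (recip σ * recip Z))     ≡⟨ solve 4 (λ z p u i → z :* (p :* (u :* i)) := (p :* u) :* (z :* i)) refl Z (P 0ℚ) (recip σ) (recip Z) ⟩
    (P 0ℚ * recip σ) * (Z * recip Z)     ≡⟨ cong ((P 0ℚ * recip σ) *_) (recip-inverseʳ Z (∏-≢0 T 0∉T)) ⟩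
    (P 0ℚ * recip σ) * 1ℚ                ≡⟨ *-identityʳ _ ⟩
    P 0ℚ * recip σ                       ∎
    where
    open ≡-Reasoning
    Z : ℚ
    Z = ∏ id T
    σ : ℚ
    σ = ∏ (λ _ → - 1ℚ) T

  ∏*divDiffTerm-x : ∀ P x r {Z} → 0ℚ ≢ x → Z ≡ x * ∏ id r → Z * divDiffTerm P (x , 0ℚ ∷ r) ≡ lagrangeTerm P (x , r)
  ∏*divDiffTerm-x P x r {Z} 0≢x Z≡ = begin
    Z * (P x * recip ((x - 0ℚ) * ∏ (_-_ x) r))
      ≡⟨ cong (λ z → Z * (P x * recip (z * ∏ (_-_ x) r))) (+-identityʳ x) ⟩
    Z * (P x * recip (x * ∏ (_-_ x) r))
      ≡⟨ cong₂ (λ a b → a * (P x * b)) Z≡ (recip-* x (∏ (_-_ x) r)) ⟩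
    x * ∏ id r * (P x * (recip x * recip (∏ (_-_ x) r)))
      ≡⟨ solve 5 (λ x l p i j → x :* l :* (p :* (i :* j)) := (x :* i) :* (p :* (l :* j))) refl x (∏ id r) (P x) (recip x) (recip (∏ (_-_ x) r)) ⟩
    (x * recip x) * lagrangeTerm P (x , r)
      ≡⟨ cong (_* lagrangeTerm P (x , r)) (recip-inverseʳ x (0≢x ∘ sym)) ⟩
    1ℚ * lagrangeTerm P (x , r)
      ≡⟨ *-identityˡ _ ⟩
    lagrangeTerm P (x , r) ∎
    where open ≡-Reasoning

  ∏*divDiff-others : ∀ P T → All (0ℚ ≢_) T →
    ∏ id T * ∑ (divDiffTerm P) (map (map₂ (0ℚ ∷_)) (select T)) ≡ ∑ (lagrangeTerm P) (select T)
  ∏*divDiff-others P T 0∉T = begin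
    Z * ∑ (divDiffTerm P) (map (map₂ (0ℚ ∷_)) (select T))
      ≡⟨ cong (Z *_) (∑-map (divDiffTerm P) (map₂ (0ℚ ∷_)) (select T)) ⟩
    Z * ∑ (λ p → divDiffTerm P (map₂ (0ℚ ∷_) p)) (select T)
      ≡⟨ sym (∑-*ˡ Z _ (select T)) ⟩
    ∑ (λ p → Z * divDiffTerm P (map₂ (0ℚ ∷_) p)) (select T)
      ≡⟨ ∑-congᴬ (terms (All-select {P = 0ℚ ≢_} 0∉T) (∏-select T)) ⟩
    ∑ (lagrangeTerm P) (select T) ∎
    where
    open ≡-Reasoning
    Z : ℚ
    Z = ∏ id T
    terms : ∀ {ps} → All (λ p → 0ℚ ≢ proj₁ p) ps → All (λ p → Z ≡ proj₁ p * ∏ id (proj₂ p)) ps →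
            All (λ p → Z * divDiffTerm P (map₂ (0ℚ ∷_) p) ≡ lagrangeTerm P p) ps
    terms [] [] = []
    terms {(x , r) ∷ _} (0≢x ∷ 0∉ps) (Z≡ ∷ Z≡s) = ∏*divDiffTerm-x P x r 0≢x Z≡ ∷ terms 0∉ps Z≡s

  -- divDiff (0ℚ ∷ T) P ≡ 0ℚ multiplied by ∏ T: Lagrange interpolation of P at 0 from the nodes T.
  lagrange-at-0 : ∀ {D P} → Degree≤ D P → ∀ T → Unique (0ℚ ∷ T) → suc D ℕ.≤ length T →
    P 0ℚ * recip (∏ (λ _ → - 1ℚ) T) + ∑ (lagrangeTerm P) (select T) ≡ 0ℚ
  lagrange-at-0 {P = P} deg T unique@(0∉T ∷ _) D+1≤|T| = begin
    P 0ℚ * recip (∏ (λ _ → - 1ℚ) T) + ∑ (lagrangeTerm P) (select T)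
      ≡⟨ cong₂ _+_ (sym (∏*divDiffTerm-0 P T 0∉T)) (sym (∏*divDiff-others P T 0∉T)) ⟩
    Z * divDiffTerm P (0ℚ , T) + Z * ∑ (divDiffTerm P) (map (map₂ (0ℚ ∷_)) (select T))
      ≡⟨ sym (*-distribˡ-+ Z _ _) ⟩
    Z * divDiff (0ℚ ∷ T) P
      ≡⟨ cong (Z *_) (divDiff-annihilates deg (0ℚ ∷ T) unique (s≤s D+1≤|T|)) ⟩
    Z * 0ℚ
      ≡⟨ *-zeroʳ Z ⟩
    0ℚ ∎
    where
    open ≡-Reasoning
    Z : ℚ
    Z = ∏ id T

  extrapolation : ∀ {D P} → Degree≤ D P → ∀ T → Unique (0ℚ ∷ T) → suc D ℕ.≤ length T →
    ∣ P 0ℚ ∣ ≤ ∑ (λ p → ∣ P (proj₁ p) ∣ * lagrangeWeight (proj₁ p) (proj₂ p)) (select T)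
  extrapolation {P = P} deg T unique D+1≤|T| = begin
    ∣ P 0ℚ ∣                       ≡⟨ sym (*-identityʳ _) ⟩
    ∣ P 0ℚ ∣ * 1ℚ                  ≡⟨ cong (∣ P 0ℚ ∣ *_) (trans (cong recip (sym (∣∏-1∣≡1 T))) (recip-∣∣ σ)) ⟩
    ∣ P 0ℚ ∣ * ∣ recip σ ∣          ≡⟨ sym (∣p*q∣≡∣p∣*∣q∣ (P 0ℚ) (recip σ)) ⟩
    ∣ P 0ℚ * recip σ ∣              ≡⟨ cong ∣_∣ (solve 2 (λ a b → a := (a :+ b) :- b) refl (P 0ℚ * recip σ) S) ⟩
    ∣ (P 0ℚ * recip σ + S) - S ∣    ≡⟨ cong (λ z → ∣ z - S ∣) (lagrange-at-0 deg T unique D+1≤|T|) ⟩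
    ∣ 0ℚ - S ∣                      ≡⟨ trans (cong ∣_∣ (+-identityˡ (- S))) (∣-p∣≡∣p∣ S) ⟩
    ∣ S ∣                           ≤⟨ ∣∑∣≤∑∣∣ (lagrangeTerm P) (select T) ⟩
    ∑ (λ p → ∣ lagrangeTerm P p ∣) (select T)
                                   ≡⟨ ∑-cong (select T) (λ { (x , r) → trans (∣p*q∣≡∣p∣*∣q∣ (P x) _) (cong (∣ P x ∣ *_) (∣∏/∏∣≡lagrangeWeight x r)) }) ⟩
    ∑ (λ p → ∣ P (proj₁ p) ∣ * lagrangeWeight (proj₁ p) (proj₂ p)) (select T) ∎
    where
    open ≤-Reasoning
    σ : ℚ
    σ = ∏ (λ _ → - 1ℚ) T
    S : ℚ
    S = ∑ (lagrangeTerm P) (select T)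

module BooleanCube where

  open import Data.Nat as ℕ using (ℕ; zero; suc; s≤s)
  import Data.Nat.Properties as ℕₚ
  open import Data.Rational
  open import Data.Rational.Properties
  open import Data.Rational.Solver using (module +-*-Solver)
  open import Data.Vec using (Vec; []; _∷_; replicate)
  open import Data.Vec.Properties using (∷-injectiveʳ)
  open import Data.Bool using (Bool; true; false)
  open import Function using (_∘_)
  open import Relation.Binary.PropositionalEquality
  open +-*-Solver
  open import Defs using (bitℚ; powℚ)
  open RationalFacts
  open DividedDifferences using (Degree≤; constant; plus-x*)

  data CubeDegree≤ : (m D : ℕ) → (Vec Bool m → ℚ) → Set where
    constant : ∀ {m D h} c → (∀ z → h z ≡ c) → CubeDegree≤ m D h
    split : ∀ {m D h} h₀ h₁ → CubeDegree≤ m (suc D) h₀ → CubeDegree≤ m D h₁ →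
            (∀ b w → h (b ∷ w) ≡ h₀ w + bitℚ b * h₁ w) → CubeDegree≤ (suc m) (suc D) h

  CubeDegree≤-cong : ∀ {m D h k} → (∀ z → h z ≡ k z) → CubeDegree≤ m D h → CubeDegree≤ m D k
  CubeDegree≤-cong h≗k (constant c h≗c) = constant c (λ z → trans (sym (h≗k z)) (h≗c z))
  CubeDegree≤-cong h≗k (split h₀ h₁ d₀ d₁ e) = split h₀ h₁ d₀ d₁ (λ b w → trans (sym (h≗k (b ∷ w))) (e b w))

  CubeDegree≤-mono : ∀ {m D D′ h} → D ℕ.≤ D′ → CubeDegree≤ m D h → CubeDegree≤ m D′ h
  CubeDegree≤-mono _ (constant c e) = constant c e
  CubeDegree≤-mono (s≤s D≤D′) (split h₀ h₁ d₀ d₁ e) =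
    split h₀ h₁ (CubeDegree≤-mono (s≤s D≤D′) d₀) (CubeDegree≤-mono D≤D′ d₁) e

  CubeDegree≤-*ˡ : ∀ {m D h} c → CubeDegree≤ m D h → CubeDegree≤ m D (λ z → c * h z)
  CubeDegree≤-*ˡ c (constant c′ e) = constant (c * c′) (λ z → cong (c *_) (e z))
  CubeDegree≤-*ˡ c (split h₀ h₁ d₀ d₁ e) = split (λ w → c * h₀ w) (λ w → c * h₁ w)
    (CubeDegree≤-*ˡ c d₀) (CubeDegree≤-*ˡ c d₁)
    (λ b w → trans (cong (c *_) (e b w)) (solve 4 (λ c a x b → c :* (a :+ x :* b) := c :* a :+ x :* (c :* b)) refl c (h₀ w) (bitℚ b) (h₁ w)))

  CubeDegree≤-+ˡ : ∀ {m D h} c → CubeDegree≤ m D h → CubeDegree≤ m D (λ z → c + h z)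
  CubeDegree≤-+ˡ c (constant c′ e) = constant (c + c′) (λ z → cong (c +_) (e z))
  CubeDegree≤-+ˡ c (split h₀ h₁ d₀ d₁ e) = split (λ w → c + h₀ w) h₁ (CubeDegree≤-+ˡ c d₀) d₁
    (λ b w → trans (cong (c +_) (e b w)) (sym (+-assoc c (h₀ w) _)))

  CubeDegree≤-+ : ∀ {m D h k} → CubeDegree≤ m D h → CubeDegree≤ m D k → CubeDegree≤ m D (λ z → h z + k z)
  CubeDegree≤-+ {k = k} (constant c e) dk = CubeDegree≤-cong (λ z → cong (_+ k z) (sym (e z))) (CubeDegree≤-+ˡ c dk)
  CubeDegree≤-+ {h = h} dh (constant c e) =
    CubeDegree≤-cong (λ z → trans (+-comm c (h z)) (cong (h z +_) (sym (e z)))) (CubeDegree≤-+ˡ c dh)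
  CubeDegree≤-+ (split h₀ h₁ d₀ d₁ e) (split k₀ k₁ f₀ f₁ e′) =
    split (λ w → h₀ w + k₀ w) (λ w → h₁ w + k₁ w) (CubeDegree≤-+ d₀ f₀) (CubeDegree≤-+ d₁ f₁)
      (λ b w → trans (cong₂ _+_ (e b w) (e′ b w))
        (solve 5 (λ a x b c d → a :+ x :* b :+ (c :+ x :* d) := a :+ c :+ x :* (b :+ d)) refl (h₀ w) (bitℚ b) (h₁ w) (k₀ w) (k₁ w)))

  bitℚ-idem : ∀ b → bitℚ b * bitℚ b ≡ bitℚ b
  bitℚ-idem true = refl
  bitℚ-idem false = refl

  -- Multilinearity: the square of a bit is the bit, so the product stays of the form h₀ + b·h₁.
  CubeDegree≤-* : ∀ {m a b h k} → CubeDegree≤ m a h → CubeDegree≤ m b k → CubeDegree≤ m (a ℕ.+ b) (λ z → h z * k z)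
  CubeDegree≤-* {a = a} {b} {k = k} (constant c e) dk =
    CubeDegree≤-cong (λ z → cong (_* k z) (sym (e z))) (CubeDegree≤-*ˡ c (CubeDegree≤-mono (ℕₚ.m≤n+m b a) dk))
  CubeDegree≤-* {a = a} {b} {h} dh (constant c e) =
    CubeDegree≤-cong (λ z → trans (*-comm c (h z)) (cong (h z *_) (sym (e z)))) (CubeDegree≤-*ˡ c (CubeDegree≤-mono (ℕₚ.m≤m+n a b) dh))
  CubeDegree≤-* {suc m} {suc a} {suc b} {h} {k} (split h₀ h₁ d₀ d₁ e) (split k₀ k₁ f₀ f₁ e′) =
    split (λ w → h₀ w * k₀ w) (λ w → h₀ w * k₁ w + h₁ w * k₀ w + h₁ w * k₁ w)
      (CubeDegree≤-* d₀ f₀)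
      (CubeDegree≤-+ (CubeDegree≤-+ (CubeDegree≤-mono a+1+b (CubeDegree≤-* d₀ f₁)) (CubeDegree≤-* d₁ f₀))
                     (CubeDegree≤-mono (ℕₚ.≤-trans (ℕₚ.n≤1+n _) a+1+b) (CubeDegree≤-* d₁ f₁)))
      expand
    where
    a+1+b : suc (a ℕ.+ b) ℕ.≤ a ℕ.+ suc b
    a+1+b = ℕₚ.≤-reflexive (sym (ℕₚ.+-suc a b))
    expand : ∀ x w → h (x ∷ w) * k (x ∷ w) ≡ h₀ w * k₀ w + bitℚ x * (h₀ w * k₁ w + h₁ w * k₀ w + h₁ w * k₁ w)
    expand x w = begin
      h (x ∷ w) * k (x ∷ w)
        ≡⟨ cong₂ _*_ (e x w) (e′ x w) ⟩
      (h₀ w + bitℚ x * h₁ w) * (k₀ w + bitℚ x * k₁ w)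
        ≡⟨ solve 5 (λ a x b c d → (a :+ x :* b) :* (c :+ x :* d) := a :* c :+ x :* (a :* d :+ b :* c) :+ (x :* x) :* (b :* d)) refl (h₀ w) (bitℚ x) (h₁ w) (k₀ w) (k₁ w) ⟩
      h₀ w * k₀ w + bitℚ x * (h₀ w * k₁ w + h₁ w * k₀ w) + (bitℚ x * bitℚ x) * (h₁ w * k₁ w)
        ≡⟨ cong (λ t → h₀ w * k₀ w + bitℚ x * (h₀ w * k₁ w + h₁ w * k₀ w) + t * (h₁ w * k₁ w)) (bitℚ-idem x) ⟩
      h₀ w * k₀ w + bitℚ x * (h₀ w * k₁ w + h₁ w * k₀ w) + bitℚ x * (h₁ w * k₁ w)
        ≡⟨ solve 4 (λ a x b c → a :+ x :* b :+ x :* c := a :+ x :* (b :+ c)) refl (h₀ w * k₀ w) (bitℚ x) (h₀ w * k₁ w + h₁ w * k₀ w) (h₁ w * k₁ w) ⟩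
      h₀ w * k₀ w + bitℚ x * (h₀ w * k₁ w + h₁ w * k₀ w + h₁ w * k₁ w) ∎
      where open ≡-Reasoning

  𝔼 : ℚ → ∀ {m} → (Vec Bool m → ℚ) → ℚ
  𝔼 s {zero} h = h []
  𝔼 s {suc m} h = (1ℚ - s) * 𝔼 s (λ w → h (false ∷ w)) + s * 𝔼 s (λ w → h (true ∷ w))

  𝔼-cong : ∀ s {m} {h k : Vec Bool m → ℚ} → (∀ z → h z ≡ k z) → 𝔼 s h ≡ 𝔼 s k
  𝔼-cong s {zero} h≗k = h≗k []
  𝔼-cong s {suc m} h≗k = cong₂ (λ a b → (1ℚ - s) * a + s * b) (𝔼-cong s (λ w → h≗k (false ∷ w))) (𝔼-cong s (λ w → h≗k (true ∷ w)))

  𝔼-+ : ∀ s {m} (h k : Vec Bool m → ℚ) → 𝔼 s (λ z → h z + k z) ≡ 𝔼 s h + 𝔼 s k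
  𝔼-+ s {zero} h k = refl
  𝔼-+ s {suc m} h k = trans
    (cong₂ (λ a b → (1ℚ - s) * a + s * b) (𝔼-+ s (λ w → h (false ∷ w)) (λ w → k (false ∷ w))) (𝔼-+ s (λ w → h (true ∷ w)) (λ w → k (true ∷ w))))
    (solve 6 (λ t s a b c d → t :* (a :+ b) :+ s :* (c :+ d) := (t :* a :+ s :* c) :+ (t :* b :+ s :* d)) refl
      (1ℚ - s) s (𝔼 s (λ w → h (false ∷ w))) (𝔼 s (λ w → k (false ∷ w))) (𝔼 s (λ w → h (true ∷ w))) (𝔼 s (λ w → k (true ∷ w))))

  𝔼-const : ∀ s {m} {h : Vec Bool m → ℚ} c → (∀ z → h z ≡ c) → 𝔼 s h ≡ c
  𝔼-const s {zero} c h≗c = h≗c []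
  𝔼-const s {suc m} c h≗c = trans
    (cong₂ (λ a b → (1ℚ - s) * a + s * b) (𝔼-const s c (λ w → h≗c (false ∷ w))) (𝔼-const s c (λ w → h≗c (true ∷ w))))
    (solve 2 (λ s c → (con 1ℚ :- s) :* c :+ s :* c := c) refl s c)

  𝔼-at-0 : ∀ {m} (h : Vec Bool m → ℚ) → 𝔼 0ℚ h ≡ h (replicate m false)
  𝔼-at-0 {zero} h = refl
  𝔼-at-0 {suc m} h = trans
    (cong (λ a → (1ℚ - 0ℚ) * a + 0ℚ * 𝔼 0ℚ (λ w → h (true ∷ w))) (𝔼-at-0 (λ w → h (false ∷ w))))
    (solve 2 (λ a b → (con 1ℚ :- con 0ℚ) :* a :+ con 0ℚ :* b := a) refl (h (false ∷ replicate m false)) (𝔼 0ℚ (λ w → h (true ∷ w))))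

  𝔼-degree : ∀ {m D h} → CubeDegree≤ m D h → Degree≤ D (λ s → 𝔼 s h)
  𝔼-degree (constant c h≗c) = constant c (λ s → 𝔼-const s c h≗c)
  𝔼-degree {suc m} {suc D} {h} (split h₀ h₁ d₀ d₁ e) = plus-x* (λ s → 𝔼 s h₀) (λ s → 𝔼 s h₁) (𝔼-degree d₀) (𝔼-degree d₁) 𝔼-split
    where
    𝔼-split : ∀ s → 𝔼 s h ≡ 𝔼 s h₀ + s * 𝔼 s h₁
    𝔼-split s = begin
      (1ℚ - s) * 𝔼 s (λ w → h (false ∷ w)) + s * 𝔼 s (λ w → h (true ∷ w))
        ≡⟨ cong₂ (λ a b → (1ℚ - s) * a + s * b)
             (𝔼-cong s (λ w → trans (e false w) (trans (cong (h₀ w +_) (*-zeroˡ (h₁ w))) (+-identityʳ (h₀ w)))))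
             (trans (𝔼-cong s (λ w → trans (e true w) (cong (h₀ w +_) (*-identityˡ (h₁ w))))) (𝔼-+ s h₀ h₁)) ⟩
      (1ℚ - s) * 𝔼 s h₀ + s * (𝔼 s h₀ + 𝔼 s h₁)
        ≡⟨ solve 3 (λ s a b → (con 1ℚ :- s) :* a :+ s :* (a :+ b) := a :+ s :* b) refl s (𝔼 s h₀) (𝔼 s h₁) ⟩
      𝔼 s h₀ + s * 𝔼 s h₁ ∎
      where open ≡-Reasoning

  powℚ-nonNeg : ∀ {q} n → 0ℚ ≤ q → 0ℚ ≤ powℚ q n
  powℚ-nonNeg zero _ = 0≤1
  powℚ-nonNeg (suc n) 0≤q = 0≤* 0≤q (powℚ-nonNeg n 0≤q)

  ∣convex∣≤ : ∀ {s a b B} → 0ℚ ≤ s → s ≤ 1ℚ → ∣ a ∣ ≤ B → ∣ b ∣ ≤ B → ∣ (1ℚ - s) * a + s * b ∣ ≤ B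
  ∣convex∣≤ {s} {a} {b} {B} 0≤s s≤1 ∣a∣≤B ∣b∣≤B = begin
    ∣ (1ℚ - s) * a + s * b ∣      ≤⟨ ∣p+q∣≤∣p∣+∣q∣ ((1ℚ - s) * a) (s * b) ⟩
    ∣ (1ℚ - s) * a ∣ + ∣ s * b ∣  ≡⟨ cong₂ _+_ (∣p*q∣≡∣p∣*∣q∣ (1ℚ - s) a) (∣p*q∣≡∣p∣*∣q∣ s b) ⟩
    ∣ 1ℚ - s ∣ * ∣ a ∣ + ∣ s ∣ * ∣ b ∣
                                  ≡⟨ cong₂ (λ x y → x * ∣ a ∣ + y * ∣ b ∣) (0≤p⇒∣p∣≡p 0≤1-s) (0≤p⇒∣p∣≡p 0≤s) ⟩
    (1ℚ - s) * ∣ a ∣ + s * ∣ b ∣  ≤⟨ +-mono-≤ (*-monoˡ-≤-0≤ 0≤1-s ∣a∣≤B) (*-monoˡ-≤-0≤ 0≤s ∣b∣≤B) ⟩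
    (1ℚ - s) * B + s * B          ≡⟨ solve 2 (λ s b → (con 1ℚ :- s) :* b :+ s :* b := b) refl s B ⟩
    B                             ∎
    where
    open ≤-Reasoning
    0≤1-s : 0ℚ ≤ 1ℚ - s
    0≤1-s = 0≤q-p s≤1

  ∣𝔼∣≤ : ∀ s {m} (h : Vec Bool m → ℚ) B → 0ℚ ≤ s → s ≤ 1ℚ → (∀ z → ∣ h z ∣ ≤ B) → ∣ 𝔼 s h ∣ ≤ B
  ∣𝔼∣≤ s {zero} h B _ _ ∣h∣≤B = ∣h∣≤B []
  ∣𝔼∣≤ s {suc m} h B 0≤s s≤1 ∣h∣≤B =
    ∣convex∣≤ 0≤s s≤1 (∣𝔼∣≤ s _ B 0≤s s≤1 (λ w → ∣h∣≤B (false ∷ w))) (∣𝔼∣≤ s _ B 0≤s s≤1 (λ w → ∣h∣≤B (true ∷ w)))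

  -- Only the all-false point escapes the bound B; it carries probability (1 - s)^m.
  ∣𝔼-origin∣≤ : ∀ s {m} (h : Vec Bool m → ℚ) B → 0ℚ ≤ B → 0ℚ ≤ s → s ≤ 1ℚ →
    (∀ z → z ≢ replicate m false → ∣ h z ∣ ≤ B) →
    ∣ 𝔼 s h - powℚ (1ℚ - s) m * h (replicate m false) ∣ ≤ B
  ∣𝔼-origin∣≤ s {zero} h B 0≤B _ _ _ =
    subst (_≤ B) (cong ∣_∣ (sym (solve 1 (λ a → a :- con 1ℚ :* a := con 0ℚ) refl (h [])))) 0≤B
  ∣𝔼-origin∣≤ s {suc m} h B 0≤B 0≤s s≤1 ∣h∣≤B = subst (_≤ B) (cong ∣_∣ (sym regroup))
    (∣convex∣≤ 0≤s s≤1
      (∣𝔼-origin∣≤ s h-false B 0≤B 0≤s s≤1 (λ w w≢0 → ∣h∣≤B (false ∷ w) (w≢0 ∘ ∷-injectiveʳ)))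
      (∣𝔼∣≤ s h-true B 0≤s s≤1 (λ w → ∣h∣≤B (true ∷ w) (λ ()))))
    where
    h-false : Vec Bool m → ℚ
    h-false = λ w → h (false ∷ w)
    h-true : Vec Bool m → ℚ
    h-true = λ w → h (true ∷ w)
    regroup : 𝔼 s h - powℚ (1ℚ - s) (suc m) * h (replicate (suc m) false)
            ≡ (1ℚ - s) * (𝔼 s h-false - powℚ (1ℚ - s) m * h-false (replicate m false)) + s * 𝔼 s h-true
    regroup = solve 6 (λ t s a b c h₀ → t :* a :+ s :* b :- (t :* c) :* h₀ := t :* (a :- c :* h₀) :+ s :* b) refl
      (1ℚ - s) s (𝔼 s h-false) (𝔼 s h-true) (powℚ (1ℚ - s) m) (h (replicate (suc m) false))

  ∣𝔼∣≤-origin : ∀ s {m} (h : Vec Bool m → ℚ) B → 0ℚ ≤ B → 0ℚ ≤ s → s ≤ 1ℚ →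
    (∀ z → z ≢ replicate m false → ∣ h z ∣ ≤ B) →
    ∣ 𝔼 s h ∣ ≤ B + powℚ (1ℚ - s) m * ∣ h (replicate m false) ∣
  ∣𝔼∣≤-origin s {m} h B 0≤B 0≤s s≤1 ∣h∣≤B = begin
    ∣ 𝔼 s h ∣               ≡⟨ cong ∣_∣ (solve 2 (λ a b → a := (a :- b) :+ b) refl (𝔼 s h) X) ⟩
    ∣ (𝔼 s h - X) + X ∣     ≤⟨ ∣p+q∣≤∣p∣+∣q∣ (𝔼 s h - X) X ⟩
    ∣ 𝔼 s h - X ∣ + ∣ X ∣   ≤⟨ +-monoˡ-≤ ∣ X ∣ (∣𝔼-origin∣≤ s h B 0≤B 0≤s s≤1 ∣h∣≤B) ⟩
    B + ∣ X ∣               ≡⟨ cong (B +_) (trans (∣p*q∣≡∣p∣*∣q∣ (powℚ (1ℚ - s) m) h₀)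
                                 (cong (_* ∣ h₀ ∣) (0≤p⇒∣p∣≡p (powℚ-nonNeg m (0≤q-p s≤1))))) ⟩
    B + powℚ (1ℚ - s) m * ∣ h₀ ∣ ∎
    where
    open ≤-Reasoning
    h₀ : ℚ
    h₀ = h (replicate m false)
    X : ℚ
    X = powℚ (1ℚ - s) m * h₀


module Substitution where

  open import Data.Nat as ℕ using (ℕ; zero; suc; s≤s; z≤n)
  import Data.Nat.Properties as ℕₚ
  open import Data.Rational
  open import Data.Rational.Properties
  open import Data.Rational.Solver using (module +-*-Solver)
  open import Data.Vec as V using (Vec; []; _∷_; lookup)
  open import Data.List using ([]; _∷_)
  open import Data.Bool using (Bool; true; false; if_then_else_)
  open import Data.Fin using (Fin; zero; suc)
  open import Data.Product using (Σ-syntax; _,_; proj₂)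
  open import Data.Sum using (_⊎_; inj₁; inj₂)
  open import Relation.Binary.PropositionalEquality
  open +-*-Solver
  open import Defs
  open BooleanCube

  CubeDegree≤-bit : ∀ {m} (i : Fin m) → CubeDegree≤ m 1 (λ z → bitℚ (lookup z i))
  CubeDegree≤-bit zero = split (λ _ → 0ℚ) (λ _ → 1ℚ) (constant 0ℚ (λ _ → refl)) (constant 1ℚ (λ _ → refl))
    (λ b w → sym (trans (+-identityˡ _) (*-identityʳ (bitℚ b))))
  CubeDegree≤-bit (suc i) = split (λ w → bitℚ (lookup w i)) (λ _ → 0ℚ) (CubeDegree≤-bit i) (constant 0ℚ (λ _ → refl))
    (λ b w → sym (trans (cong (bitℚ (lookup w i) +_) (*-zeroʳ (bitℚ b))) (+-identityʳ _)))

  bitℚ-if : ∀ x A B → bitℚ (if x then A else B) ≡ bitℚ B + (bitℚ A - bitℚ B) * bitℚ x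
  bitℚ-if true A B = solve 2 (λ a b → a := b :+ (a :- b) :* con 1ℚ) refl (bitℚ A) (bitℚ B)
  bitℚ-if false A B = solve 2 (λ a b → b := b :+ (a :- b) :* con 0ℚ) refl (bitℚ A) (bitℚ B)

  CubeDegree≤-if : ∀ {m} (i : Fin m) A B → CubeDegree≤ m 1 (λ z → bitℚ (if lookup z i then A else B))
  CubeDegree≤-if i A B = CubeDegree≤-cong (λ z → sym (bitℚ-if (lookup z i) A B))
    (CubeDegree≤-+ˡ (bitℚ B) (CubeDegree≤-*ˡ (bitℚ A - bitℚ B) (CubeDegree≤-bit i)))

  powℚ-bitℚ : ∀ b e → powℚ (bitℚ b) (suc e) ≡ bitℚ b
  powℚ-bitℚ true zero = refl
  powℚ-bitℚ true (suc e) = trans (*-identityˡ _) (powℚ-bitℚ true e)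
  powℚ-bitℚ false e = *-zeroˡ (powℚ 0ℚ e)

  Coordinates1Junta : ∀ {m n} → (Vec Bool m → Input n) → Set
  Coordinates1Junta {m} {n} g = ∀ (v : Fin n) →
    (Σ[ B ∈ Bool ] ∀ z → g z v ≡ B) ⊎ (Σ[ i ∈ Fin m ] Σ[ A ∈ Bool ] Σ[ B ∈ Bool ] ∀ z → g z v ≡ (if lookup z i then A else B))

  module _ {m n} (g : Vec Bool m → Input n) (g-1junta : Coordinates1Junta g) where

    coordinate-degree : ∀ v → CubeDegree≤ m 1 (λ z → bitℚ (g z v))
    coordinate-degree v with g-1junta v
    ... | inj₁ (B , g≗B) = constant (bitℚ B) (λ z → cong bitℚ (g≗B z))
    ... | inj₂ (i , A , B , g≗if) = CubeDegree≤-cong (λ z → cong bitℚ (sym (g≗if z))) (CubeDegree≤-if i A B)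

    power-degree : ∀ v e → CubeDegree≤ m e (λ z → powℚ (bitℚ (g z v)) e)
    power-degree v zero = constant 1ℚ (λ _ → refl)
    power-degree v (suc e) = CubeDegree≤-cong (λ z → sym (powℚ-bitℚ (g z v) e))
      (CubeDegree≤-mono (s≤s z≤n) (coordinate-degree v))

    monomial-degree′ : ∀ {l} (vs : Vec (Fin n) l) (es : Vec ℕ l) →
      CubeDegree≤ m (V.foldr _ ℕ._+_ 0 es) (λ z → V.foldr _ _*_ 1ℚ (V.zipWith (λ v e → powℚ (bitℚ (g z v)) e) vs es))
    monomial-degree′ [] [] = constant 1ℚ (λ _ → refl)
    monomial-degree′ (v ∷ vs) (e ∷ es) = CubeDegree≤-* (power-degree v e) (monomial-degree′ vs es)

    monomial-degree : ∀ (mono : Monomial n) → CubeDegree≤ m (V.foldr _ ℕ._+_ 0 (proj₂ mono)) (λ z → evalMono mono (g z))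
    monomial-degree (c , es) = CubeDegree≤-*ˡ c (monomial-degree′ (V.allFin n) es)

    evalPoly-degree : ∀ (p : Poly n) → CubeDegree≤ m (degree p) (λ z → evalPoly p (g z))
    evalPoly-degree [] = constant 0ℚ (λ _ → refl)
    evalPoly-degree (mono ∷ p) = CubeDegree≤-+
      (CubeDegree≤-mono (ℕₚ.m≤m⊔n _ (degree p)) (monomial-degree mono))
      (CubeDegree≤-mono (ℕₚ.m≤n⊔m (V.foldr _ ℕ._+_ 0 (proj₂ mono)) (degree p)) (evalPoly-degree p))


module NodeProducts where

  open import Data.Nat
  open import Data.Nat.Properties
  open import Data.Nat.ListAction using (product)
  open import Data.Nat.Solver using (module +-*-Solver)
  open import Data.List using (List; []; _∷_; map; length)
  open import Data.List.Relation.Unary.All using (All; []; _∷_)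
  open import Data.Product using (_×_; _,_; proj₁; proj₂; map₂)
  open import Relation.Binary.PropositionalEquality
  open +-*-Solver
  open FiniteSums using (select)

  countdown : ℕ → List ℕ
  countdown zero = []
  countdown (suc D) = suc D ∷ countdown D

  length-countdown : ∀ D → length (countdown D) ≡ D
  length-countdown zero = refl
  length-countdown (suc D) = cong suc (length-countdown D)

  countdown-bounds : ∀ D → All (λ j → 1 ≤ j × j ≤ D) (countdown D)
  countdown-bounds zero = []
  countdown-bounds (suc D) = (s≤s z≤n , ≤-refl) ∷ weaken (countdown-bounds D)
    where
    weaken : ∀ {js} → All (λ j → 1 ≤ j × j ≤ D) js → All (λ j → 1 ≤ j × j ≤ suc D) js
    weaken [] = []
    weaken ((1≤j , j≤D) ∷ rest) = (1≤j , m≤n⇒m≤1+n j≤D) ∷ weaken rest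

  squares : List ℕ → ℕ
  squares r = product (map (λ i → i * i) r)

  -- ∏ᵢ |j² - i²|, written with ∣ j - i ∣ · (j + i) to stay in ℕ.
  gaps : ℕ → List ℕ → ℕ
  gaps j r = product (map (λ i → ∣ j - i ∣ * (j + i)) r)

  product-map-* : ∀ (f g : ℕ → ℕ) r → product (map (λ i → f i * g i) r) ≡ product (map f r) * product (map g r)
  product-map-* f g [] = refl
  product-map-* f g (i ∷ r) = trans (cong (f i * g i *_) (product-map-* f g r))
    (solve 4 (λ a b c d → a :* b :* (c :* d) := a :* c :* (b :* d)) refl (f i) (g i) (product (map f r)) (product (map g r)))

  squares-countdown : ∀ D → squares (countdown D) ≡ D ! * D !
  squares-countdown zero = refl
  squares-countdown (suc D) = trans (cong (suc D * suc D *_) (squares-countdown D))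
    (solve 2 (λ d f → (con 1 :+ d) :* (con 1 :+ d) :* (f :* f) := ((con 1 :+ d) :* f) :* ((con 1 :+ d) :* f)) refl D (D !))

  ∣k+D-D∣≡k : ∀ k D → ∣ k + D - D ∣ ≡ k
  ∣k+D-D∣≡k k D = trans (cong ∣_- D ∣ (+-comm k D)) (trans (∣-∣-comm (D + k) D) (∣m-m+n∣≡n D k))

  ∏∣n-i∣-countdown : ∀ D s → product (map (λ i → ∣ suc (s + D) - i ∣) (countdown D)) * s ! ≡ (s + D) !
  ∏∣n-i∣-countdown zero s = trans (*-identityˡ (s !)) (cong _! (sym (+-identityʳ s)))
  ∏∣n-i∣-countdown (suc D) s = begin
    ∣ suc (s + suc D) - suc D ∣ * Π (s + suc D) * s !  ≡⟨ cong (λ z → ∣ suc z - suc D ∣ * Π z * s !) (+-suc s D) ⟩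
    ∣ suc s + D - D ∣ * Π (suc s + D) * s !            ≡⟨ cong (λ z → z * Π (suc s + D) * s !) (∣k+D-D∣≡k (suc s) D) ⟩
    suc s * Π (suc s + D) * s !                        ≡⟨ solve 3 (λ s p f → (con 1 :+ s) :* p :* f := p :* ((con 1 :+ s) :* f)) refl s (Π (suc s + D)) (s !) ⟩
    Π (suc s + D) * suc s !                            ≡⟨ ∏∣n-i∣-countdown D (suc s) ⟩
    (suc s + D) !                                      ≡⟨ cong _! (sym (+-suc s D)) ⟩
    (s + suc D) !                                      ∎
    where
    open ≡-Reasoning
    Π : ℕ → ℕ
    Π t = product (map (λ i → ∣ suc t - i ∣) (countdown D))

  ∏s+i-countdown : ∀ D s → product (map (s +_) (countdown D)) * s ! ≡ (s + D) !
  ∏s+i-countdown zero s = trans (*-identityˡ (s !)) (cong _! (sym (+-identityʳ s)))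
  ∏s+i-countdown (suc D) s = begin
    (s + suc D) * product (map (s +_) (countdown D)) * s !    ≡⟨ *-assoc (s + suc D) _ (s !) ⟩
    (s + suc D) * (product (map (s +_) (countdown D)) * s !)  ≡⟨ cong ((s + suc D) *_) (∏s+i-countdown D s) ⟩
    (s + suc D) * (s + D) !                                   ≡⟨ cong (λ z → z * (s + D) !) (+-suc s D) ⟩
    suc (s + D) !                                             ≡⟨ cong _! (sym (+-suc s D)) ⟩
    (s + suc D) !                                             ∎
    where open ≡-Reasoning

  NodeIdentity : ℕ → ℕ × List ℕ → Set
  NodeIdentity D (j , r) = 1 ≤ j × j ≤ D × squares r * ((D ∸ j) ! * (D + j) !) ≡ 2 * (D ! * D !) * gaps j r

  node-identity-top : ∀ D → NodeIdentity (suc D) (suc D , countdown D)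
  node-identity-top D = s≤s z≤n , ≤-refl , *-cancelʳ-≡ LHS RHS (suc D * f) {{suc D !≢0}} key
    where
    open ≡-Reasoning
    f : ℕ
    f = D !
    X : ℕ
    X = (suc (D + D)) !
    Pd : ℕ
    Pd = product (map (λ i → ∣ suc D - i ∣) (countdown D))
    Ps : ℕ
    Ps = product (map (suc D +_) (countdown D))
    LHS : ℕ
    LHS = squares (countdown D) * ((suc D ∸ suc D) ! * (suc D + suc D) !)
    RHS : ℕ
    RHS = 2 * (suc D ! * suc D !) * gaps (suc D) (countdown D)
    LHS≡ : LHS ≡ f * f * (1 * (suc (suc (D + D)) * X))
    LHS≡ = trans (cong₂ (λ a b → a * (b ! * (suc D + suc D) !)) (squares-countdown D) (n∸n≡0 D))
                 (cong (λ z → f * f * (1 * suc z !)) (+-suc D D))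
    key : LHS * (suc D * f) ≡ RHS * (suc D * f)
    key = begin
      LHS * (suc D * f)
        ≡⟨ cong (_* (suc D * f)) LHS≡ ⟩
      f * f * (1 * (suc (suc (D + D)) * X)) * (suc D * f)
        ≡⟨ solve 3 (λ d f x → f :* f :* (con 1 :* ((con 2 :+ (d :+ d)) :* x)) :* ((con 1 :+ d) :* f)
                             := con 2 :* (((con 1 :+ d) :* f) :* ((con 1 :+ d) :* f)) :* (f :* x)) refl D f X ⟩
      2 * (suc D ! * suc D !) * (f * X)
        ≡⟨ cong (λ z → 2 * (suc D ! * suc D !) * (z * X)) (sym (trans (sym (*-identityʳ Pd)) (∏∣n-i∣-countdown D 0))) ⟩
      2 * (suc D ! * suc D !) * (Pd * X)
        ≡⟨ cong (λ z → 2 * (suc D ! * suc D !) * (Pd * z)) (sym (∏s+i-countdown D (suc D))) ⟩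
      2 * (suc D ! * suc D !) * (Pd * (Ps * (suc D * f)))
        ≡⟨ solve 4 (λ c p q s → c :* (p :* (q :* s)) := c :* (p :* q) :* s) refl (2 * (suc D ! * suc D !)) Pd Ps (suc D * f) ⟩
      2 * (suc D ! * suc D !) * (Pd * Ps) * (suc D * f)
        ≡⟨ cong (λ z → 2 * (suc D ! * suc D !) * z * (suc D * f)) (sym (product-map-* (λ i → ∣ suc D - i ∣) (suc D +_) (countdown D))) ⟩
      RHS * (suc D * f) ∎

  node-identity-step : ∀ D p → NodeIdentity D p → NodeIdentity (suc D) (map₂ (suc D ∷_) p)
  node-identity-step D (j , r) (1≤j , j≤D , e) = 1≤j , m≤n⇒m≤1+n j≤D , identity
    where
    open ≡-Reasoning
    E : ℕ
    E = D ∸ j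
    F : ℕ
    F = D + j
    f : ℕ
    f = D !
    A : ℕ
    A = squares r
    B : ℕ
    B = gaps j r
    ∣j-D-1∣≡ : ∣ j - suc D ∣ ≡ suc E
    ∣j-D-1∣≡ = trans (m≤n⇒∣m-n∣≡n∸m (m≤n⇒m≤1+n j≤D)) (+-∸-assoc 1 j≤D)
    j+D+1≡ : j + suc D ≡ suc F
    j+D+1≡ = trans (+-suc j D) (cong suc (+-comm j D))
    identity : squares (suc D ∷ r) * ((suc D ∸ j) ! * (suc D + j) !) ≡ 2 * (suc D ! * suc D !) * gaps j (suc D ∷ r)
    identity = begin
      (suc D * suc D) * A * ((suc D ∸ j) ! * (suc F) !)
        ≡⟨ cong (λ z → (suc D * suc D) * A * (z ! * (suc F) !)) (+-∸-assoc 1 j≤D) ⟩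
      (suc D * suc D) * A * ((suc E * E !) * (suc F * F !))
        ≡⟨ solve 6 (λ d a se e sf ff → (d :* d) :* a :* ((se :* e) :* (sf :* ff)) := (d :* d) :* se :* sf :* (a :* (e :* ff))) refl (suc D) A (suc E) (E !) (suc F) (F !) ⟩
      (suc D * suc D) * suc E * suc F * (A * (E ! * F !))
        ≡⟨ cong ((suc D * suc D) * suc E * suc F *_) e ⟩
      (suc D * suc D) * suc E * suc F * (2 * (f * f) * B)
        ≡⟨ solve 5 (λ d se sf f b → (d :* d) :* se :* sf :* (con 2 :* (f :* f) :* b) := con 2 :* ((d :* f) :* (d :* f)) :* ((se :* sf) :* b)) refl (suc D) (suc E) (suc F) f B ⟩
      2 * (suc D ! * suc D !) * ((suc E * suc F) * B)
        ≡⟨ cong₂ (λ a b → 2 * (suc D ! * suc D !) * ((a * b) * B)) (sym ∣j-D-1∣≡) (sym j+D+1≡) ⟩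
      2 * (suc D ! * suc D !) * gaps j (suc D ∷ r) ∎

  node-identity : ∀ D → All (NodeIdentity D) (select (countdown D))
  node-identity zero = []
  node-identity (suc D) = node-identity-top D ∷ step (node-identity D)
    where
    step : ∀ {ps} → All (NodeIdentity D) ps → All (NodeIdentity (suc D)) (map (map₂ (suc D ∷_)) ps)
    step [] = []
    step {p ∷ _} (w ∷ ws) = node-identity-step D p w ∷ step ws

  !-log-convex : ∀ j e → (e + j) ! * (e + j) ! ≤ e ! * (e + j + j) !
  !-log-convex zero e rewrite +-identityʳ e | +-identityʳ e = ≤-refl
  !-log-convex (suc j) e = begin
    (e + suc j) ! * (e + suc j) !        ≡⟨ cong (λ z → z ! * z !) (+-suc e j) ⟩
    (suc e + j) ! * (suc e + j) !        ≤⟨ !-log-convex j (suc e) ⟩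
    suc e ! * X                          ≡⟨ *-assoc (suc e) (e !) X ⟩
    suc e * (e ! * X)                    ≤⟨ *-monoˡ-≤ (e ! * X) (s≤s (m≤n⇒m≤1+n (≤-trans (m≤m+n e j) (m≤m+n (e + j) j)))) ⟩
    suc (suc e + j + j) * (e ! * X)      ≡⟨ solve 3 (λ a b c → a :* (b :* c) := b :* (a :* c)) refl (suc (suc e + j + j)) (e !) X ⟩
    e ! * (suc (suc e + j + j)) !        ≡⟨ cong (λ z → e ! * z !) reassoc ⟩
    e ! * ((e + suc j) + suc j) !        ∎
    where
    open ≤-Reasoning
    X : ℕ
    X = (suc e + j + j) !
    reassoc : suc (suc e + j + j) ≡ (e + suc j) + suc j
    reassoc = trans (cong suc (sym (+-suc (e + j) j))) (cong (_+ suc j) (sym (+-suc e j)))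

  D!²≤[D∸j]![D+j]! : ∀ {j D} → j ≤ D → D ! * D ! ≤ (D ∸ j) ! * (D + j) !
  D!²≤[D∸j]![D+j]! {j} {D} j≤D = subst₂ (λ a b → a ! * a ! ≤ (D ∸ j) ! * (b + j) !) D∸j+j≡D D∸j+j≡D (!-log-convex j (D ∸ j))
    where
    D∸j+j≡D : D ∸ j + j ≡ D
    D∸j+j≡D = m∸n+n≡m j≤D

  squares≤2*gaps : ∀ D → All (λ p → squares (proj₂ p) ≤ 2 * gaps (proj₁ p) (proj₂ p)) (select (countdown D))
  squares≤2*gaps D = bound (node-identity D)
    where
    bound : ∀ {ps} → All (NodeIdentity D) ps → All (λ p → squares (proj₂ p) ≤ 2 * gaps (proj₁ p) (proj₂ p)) ps
    bound [] = []
    bound {(j , r) ∷ _} ((_ , j≤D , e) ∷ ws) = bound₁ ∷ bound ws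
      where
      X : ℕ
      X = (D ∸ j) ! * (D + j) !
      bound₁ : squares r ≤ 2 * gaps j r
      bound₁ = *-cancelʳ-≤ (squares r) (2 * gaps j r) X {{(D ∸ j) !* (D + j) !≢0}} (begin
        squares r * X               ≡⟨ e ⟩
        2 * (D ! * D !) * gaps j r  ≤⟨ *-monoˡ-≤ (gaps j r) (*-monoʳ-≤ 2 (D!²≤[D∸j]![D+j]! j≤D)) ⟩
        2 * X * gaps j r            ≡⟨ solve 2 (λ a b → con 2 :* a :* b := con 2 :* b :* a) refl X (gaps j r) ⟩
        2 * gaps j r * X            ∎)
        where open ≤-Reasoning


module Estimates where

  open import Data.Nat as ℕ using (ℕ; zero; suc; s≤s; z≤n)
  import Data.Nat.Properties as ℕₚ
  import Data.Nat.Solver as ℕ-Solver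
  open import Data.Rational
  open import Data.Rational.Properties
  open import Data.Rational.Solver using (module +-*-Solver)
  open import Relation.Binary.PropositionalEquality
  open +-*-Solver
  open import Defs using (powℚ)
  open RationalFacts
  open FiniteSums
  open NodeProducts using (countdown)
  open BooleanCube using (powℚ-nonNeg)

  telescope-step : ∀ D → (1 ℕ.* suc (suc D) ℕ.+ 2 ℕ.* (suc D ℕ.* suc D)) ℕ.* suc D ℕ.≤ 2 ℕ.* ((suc D ℕ.* suc D) ℕ.* suc (suc D))
  telescope-step D = ℕₚ.≤-trans (ℕₚ.m≤m+n _ (D ℕ.* suc D)) (ℕₚ.≤-reflexive expand)
    where
    open ℕ-Solver.+-*-Solver using () renaming (solve to ℕ-solve; _:+_ to _⊕_; _:*_ to _⊗_; _:=_ to _≐_; con to ℕ-con)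
    expand : (1 ℕ.* suc (suc D) ℕ.+ 2 ℕ.* (suc D ℕ.* suc D)) ℕ.* suc D ℕ.+ D ℕ.* suc D ≡ 2 ℕ.* ((suc D ℕ.* suc D) ℕ.* suc (suc D))
    expand = ℕ-solve 1 (λ d → (ℕ-con 1 ⊗ (ℕ-con 2 ⊕ d) ⊕ ℕ-con 2 ⊗ ((ℕ-con 1 ⊕ d) ⊗ (ℕ-con 1 ⊕ d))) ⊗ (ℕ-con 1 ⊕ d) ⊕ d ⊗ (ℕ-con 1 ⊕ d)
                             ≐ ℕ-con 2 ⊗ (((ℕ-con 1 ⊕ d) ⊗ (ℕ-con 1 ⊕ d)) ⊗ (ℕ-con 2 ⊕ d))) refl D

  -- Telescoping: 1/(D+1)² + 2/(D+2) ≤ 2/(D+1).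
  ∑1/j²+2/[D+1]≤2 : ∀ D → ∑ (λ j → 1 /ℕ (j ℕ.* j)) (countdown D) + 2 /ℕ suc D ≤ ι 2
  ∑1/j²+2/[D+1]≤2 zero = ≤-refl
  ∑1/j²+2/[D+1]≤2 (suc D) = begin
    (1 /ℕ (suc D ℕ.* suc D) + S) + 2 /ℕ suc (suc D)
      ≡⟨ solve 3 (λ a b c → (a :+ b) :+ c := b :+ (a :+ c)) refl (1 /ℕ (suc D ℕ.* suc D)) S (2 /ℕ suc (suc D)) ⟩
    S + (1 /ℕ (suc D ℕ.* suc D) + 2 /ℕ suc (suc D))
      ≡⟨ cong (S +_) (/ℕ-+ 1 (suc D ℕ.* suc D) 2 (suc (suc D)) (s≤s z≤n) (s≤s z≤n)) ⟩
    S + (1 ℕ.* suc (suc D) ℕ.+ 2 ℕ.* (suc D ℕ.* suc D)) /ℕ ((suc D ℕ.* suc D) ℕ.* suc (suc D))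
      ≤⟨ +-monoʳ-≤ S (/ℕ-mono-≤ (1 ℕ.* suc (suc D) ℕ.+ 2 ℕ.* (suc D ℕ.* suc D)) ((suc D ℕ.* suc D) ℕ.* suc (suc D)) 2 (suc D) (s≤s z≤n) (s≤s z≤n) (telescope-step D)) ⟩
    S + 2 /ℕ suc D
      ≤⟨ ∑1/j²+2/[D+1]≤2 D ⟩
    ι 2 ∎
    where
    open ≤-Reasoning
    S : ℚ
    S = ∑ (λ j → 1 /ℕ (j ℕ.* j)) (countdown D)

  ∑1/j²≤2 : ∀ D → ∑ (λ j → 1 /ℕ (j ℕ.* j)) (countdown D) ≤ ι 2
  ∑1/j²≤2 D = ≤-trans (subst (_≤ S + 2 /ℕ suc D) (+-identityʳ S) (+-monoʳ-≤ S (/ℕ-nonNeg 2 (suc D)))) (∑1/j²+2/[D+1]≤2 D)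
    where
    S : ℚ
    S = ∑ (λ j → 1 /ℕ (j ℕ.* j)) (countdown D)

  bernoulli : ∀ m u → 0ℚ ≤ u → u ≤ 1ℚ → powℚ (1ℚ - u) m * (1ℚ + ι m * u) ≤ 1ℚ
  bernoulli zero u _ _ = ≤-reflexive (solve 1 (λ u → con 1ℚ :* (con 1ℚ :+ con 0ℚ :* u) := con 1ℚ) refl u)
  bernoulli (suc m) u 0≤u u≤1 = begin
    (1ℚ - u) * p * (1ℚ + (1ℚ + ι m) * u)
      ≡⟨ solve 3 (λ u p x → (con 1ℚ :- u) :* p :* (con 1ℚ :+ (con 1ℚ :+ x) :* u) := p :* (con 1ℚ :+ x :* u) :- p :* ((con 1ℚ :+ x) :* (u :* u))) refl u p (ι m) ⟩
    p * (1ℚ + ι m * u) - p * ((1ℚ + ι m) * (u * u))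
      ≤⟨ p-q≤p (0≤* 0≤p (0≤* (ι-nonNeg (suc m)) (0≤* 0≤u 0≤u))) ⟩
    p * (1ℚ + ι m * u)
      ≤⟨ bernoulli m u 0≤u u≤1 ⟩
    1ℚ ∎
    where
    open ≤-Reasoning
    p : ℚ
    p = powℚ (1ℚ - u) m
    0≤p : 0ℚ ≤ p
    0≤p = powℚ-nonNeg m (0≤q-p u≤1)

  powℚ-≤1 : ∀ m q → 0ℚ ≤ q → q ≤ 1ℚ → powℚ q m ≤ 1ℚ
  powℚ-≤1 zero q _ _ = ≤-refl
  powℚ-≤1 (suc m) q 0≤q q≤1 = subst (q * powℚ q m ≤_) (*-identityˡ 1ℚ) (*-mono-≤-0≤ 0≤q (powℚ-nonNeg m 0≤q) q≤1 (powℚ-≤1 m q 0≤q q≤1))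


module OrLowerBound where

  open import Data.Nat as ℕ using (ℕ; zero; suc; s≤s; z≤n)
  import Data.Nat.Properties as ℕₚ
  import Data.Nat.Solver as ℕ-Solver
  open import Data.Rational
  open import Data.Rational.Properties
  open import Data.Rational.Solver using (module +-*-Solver)
  open import Data.List using (List; []; _∷_; map; length)
  open import Data.List.Properties using (length-map)
  open import Data.List.Relation.Unary.All as All using (All; []; _∷_)
  open import Data.List.Relation.Unary.All.Properties using (map⁺)
  open import Data.List.Relation.Unary.AllPairs using ([]; _∷_)
  open import Data.List.Relation.Unary.Unique.Propositional using (Unique)
  open import Data.Product using (_×_; _,_; proj₁; map₂)
  open import Data.Vec using (Vec; _∷_; replicate)
  open import Data.Bool using (Bool; true; false)
  open import Data.Empty using (⊥; ⊥-elim)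
  open import Relation.Nullary using (yes; no)
  open import Relation.Nullary.Decidable using (toWitness)
  open import Relation.Binary.PropositionalEquality
  open +-*-Solver
  open import Defs using (powℚ; oneThird)
  open RationalFacts
  open FiniteSums
  open DividedDifferences
  open BooleanCube
  open NodeProducts
  open Estimates

  /ℕ-monoˡ-< : ∀ {a b} m → 0 ℕ.< m → a ℕ.< b → a /ℕ m < b /ℕ m
  /ℕ-monoˡ-< (suc m) _ a<b = *-monoˡ-<-pos (recip (ι (suc m))) {{positive (recip-pos (ι-pos m))}} (ι-mono-< a<b)

  ∣a/m∣/∣b/m-a/m∣ : ∀ m a b → 0 ℕ.< m → ∣ a /ℕ m ∣ * recip ∣ b /ℕ m - a /ℕ m ∣ ≡ a /ℕ ℕ.∣ b - a ∣
  ∣a/m∣/∣b/m-a/m∣ (suc m) a b _ = begin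
    ∣ ι a * μ ∣ * recip ∣ ι b * μ - ι a * μ ∣
      ≡⟨ cong₂ (λ x y → x * recip ∣ y ∣) (0≤p⇒∣p∣≡p (/ℕ-nonNeg a (suc m))) (solve 3 (λ b a u → b :* u :- a :* u := (b :- a) :* u) refl (ι b) (ι a) μ) ⟩
    ι a * μ * recip ∣ (ι b - ι a) * μ ∣
      ≡⟨ cong (λ z → ι a * μ * recip z) (trans (∣p*q∣≡∣p∣*∣q∣ (ι b - ι a) μ) (cong₂ _*_ (ι-∣-∣ b a) (0≤p⇒∣p∣≡p (recip-nonNeg (ι-nonNeg (suc m)))))) ⟩
    ι a * μ * recip (ι ℕ.∣ b - a ∣ * μ)
      ≡⟨ cong (ι a * μ *_) (recip-* (ι ℕ.∣ b - a ∣) μ) ⟩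
    ι a * μ * (recip (ι ℕ.∣ b - a ∣) * recip μ)
      ≡⟨ solve 4 (λ a u d iu → a :* u :* (d :* iu) := (a :* d) :* (u :* iu)) refl (ι a) μ (recip (ι ℕ.∣ b - a ∣)) (recip μ) ⟩
    a /ℕ ℕ.∣ b - a ∣ * (μ * recip μ)
      ≡⟨ cong (a /ℕ ℕ.∣ b - a ∣ *_) (recip-inverseʳ μ (0<⇒≢0 (recip-pos (ι-pos m)))) ⟩
    a /ℕ ℕ.∣ b - a ∣ * 1ℚ
      ≡⟨ *-identityʳ _ ⟩
    a /ℕ ℕ.∣ b - a ∣ ∎
    where
    open ≡-Reasoning
    μ : ℚ
    μ = recip (ι (suc m))

  lagrangeWeight-/ℕ : ∀ m a (g : ℕ → ℕ) r → 0 ℕ.< m →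
    lagrangeWeight (a /ℕ m) (map (λ i → g i /ℕ m) r) ≡ ∏ (λ i → g i /ℕ ℕ.∣ a - g i ∣) r
  lagrangeWeight-/ℕ m a g [] _ = refl
  lagrangeWeight-/ℕ m a g (i ∷ r) 0<m = cong₂ _*_ (∣a/m∣/∣b/m-a/m∣ m (g i) a 0<m) (lagrangeWeight-/ℕ m a g r 0<m)

  farIdx : ℕ → ℕ
  farIdx j = j ℕ.* j ℕ.* 200

  1≤j*j : ∀ {j} → 1 ℕ.≤ j → 1 ℕ.≤ j ℕ.* j
  1≤j*j {suc j} _ = s≤s z≤n

  200≤farIdx : ∀ {j} → 1 ℕ.≤ j → 200 ℕ.≤ farIdx j
  200≤farIdx 1≤j = ℕₚ.*-monoˡ-≤ 200 (1≤j*j 1≤j)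

  5≤farIdx : ∀ {j} → 1 ℕ.≤ j → 5 ℕ.≤ farIdx j
  5≤farIdx 1≤j = ℕₚ.≤-trans (ℕₚ.m≤m+n 5 195) (200≤farIdx 1≤j)

  farIdx-mono-≤ : ∀ {i j} → i ℕ.≤ j → farIdx i ℕ.≤ farIdx j
  farIdx-mono-≤ i≤j = ℕₚ.*-monoˡ-≤ 200 (ℕₚ.*-mono-≤ i≤j i≤j)

  farIdx-mono-< : ∀ {i j} → i ℕ.< j → farIdx i ℕ.< farIdx j
  farIdx-mono-< i<j = ℕₚ.*-monoˡ-< 200 (ℕₚ.*-mono-< i<j i<j)

  headRatio : ℕ → ℚ
  headRatio j = farIdx j /ℕ ℕ.∣ 5 - farIdx j ∣

  headShare : ℕ → ℚ
  headShare j = 5 /ℕ farIdx j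

  headRatio*[1-headShare]≡1 : ∀ {j} → 1 ℕ.≤ j → headRatio j * (1ℚ - headShare j) ≡ 1ℚ
  headRatio*[1-headShare]≡1 {j} 1≤j = begin
    X * recip Yd * (1ℚ - ι 5 * recip X)         ≡⟨ cong (λ z → X * recip z * (1ℚ - ι 5 * recip X)) Yd≡Y ⟩
    X * Y⁻¹ * (1ℚ - ι 5 * recip X)              ≡⟨ solve 5 (λ x iy f ix o → x :* iy :* (o :- f :* ix) := x :* iy :* o :- f :* iy :* (x :* ix)) refl X Y⁻¹ (ι 5) (recip X) 1ℚ ⟩
    X * Y⁻¹ * 1ℚ - ι 5 * Y⁻¹ * (X * recip X)    ≡⟨ cong (λ z → X * Y⁻¹ * 1ℚ - ι 5 * Y⁻¹ * z) (recip-inverseʳ X X≢0) ⟩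
    X * Y⁻¹ * 1ℚ - ι 5 * Y⁻¹ * 1ℚ              ≡⟨ cong (λ z → z * Y⁻¹ * 1ℚ - ι 5 * Y⁻¹ * 1ℚ) X≡Y+5 ⟩
    (Y + ι 5) * Y⁻¹ * 1ℚ - ι 5 * Y⁻¹ * 1ℚ       ≡⟨ solve 3 (λ y f iy → (y :+ f) :* iy :* con 1ℚ :- f :* iy :* con 1ℚ := y :* iy) refl Y (ι 5) Y⁻¹ ⟩
    Y * Y⁻¹                                     ≡⟨ recip-inverseʳ Y Y≢0 ⟩
    1ℚ                                          ∎
    where
    open ≡-Reasoning
    X : ℚ
    X = ι (farIdx j)
    Yd : ℚ
    Yd = ι ℕ.∣ 5 - farIdx j ∣
    Y : ℚ
    Y = ι (farIdx j ℕ.∸ 5)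
    Y⁻¹ : ℚ
    Y⁻¹ = recip Y
    Yd≡Y : Yd ≡ Y
    Yd≡Y = cong ι (ℕₚ.m≤n⇒∣m-n∣≡n∸m (5≤farIdx 1≤j))
    X≡Y+5 : X ≡ Y + ι 5
    X≡Y+5 = trans (cong ι (sym (ℕₚ.m∸n+n≡m (5≤farIdx 1≤j)))) (ι-+ (farIdx j ℕ.∸ 5) 5)
    X≢0 : X ≢ 0ℚ
    X≢0 = 0<⇒≢0 (<-≤-trans (ι-pos 4) (ι-mono-≤ (5≤farIdx 1≤j)))
    Y≢0 : Y ≢ 0ℚ
    Y≢0 = 0<⇒≢0 (<-≤-trans (ι-pos 0) (ι-mono-≤ (ℕₚ.≤-trans (s≤s z≤n) (ℕₚ.∸-monoˡ-≤ 5 (200≤farIdx 1≤j)))))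

  1≤headRatio : ∀ {j} → 1 ℕ.≤ j → 1ℚ ≤ headRatio j
  1≤headRatio {j} 1≤j = /ℕ-mono-≤ 1 1 (farIdx j) ℕ.∣ 5 - farIdx j ∣ (s≤s z≤n) 0<gap
    (subst₂ ℕ._≤_ (sym (ℕₚ.*-identityˡ _)) (sym (ℕₚ.*-identityʳ _)) (subst (ℕ._≤ farIdx j) (sym gap≡) (ℕₚ.m∸n≤m (farIdx j) 5)))
    where
    gap≡ : ℕ.∣ 5 - farIdx j ∣ ≡ farIdx j ℕ.∸ 5
    gap≡ = ℕₚ.m≤n⇒∣m-n∣≡n∸m (5≤farIdx 1≤j)
    0<gap : 0 ℕ.< ℕ.∣ 5 - farIdx j ∣
    0<gap = subst (0 ℕ.<_) (sym gap≡) (ℕₚ.≤-trans (s≤s z≤n) (ℕₚ.∸-monoˡ-≤ 5 (200≤farIdx 1≤j)))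

  headShare≡ : ∀ j → headShare j ≡ recip (ι 40) * 1 /ℕ (j ℕ.* j)
  headShare≡ j = begin
    ι 5 * recip (ι (j ℕ.* j ℕ.* 200))               ≡⟨ cong (λ z → ι 5 * recip z) (ι-* (j ℕ.* j) 200) ⟩
    ι 5 * recip (ι (j ℕ.* j) * ι 200)               ≡⟨ cong (ι 5 *_) (recip-* (ι (j ℕ.* j)) (ι 200)) ⟩
    ι 5 * (recip (ι (j ℕ.* j)) * recip (ι 200))     ≡⟨ solve 3 (λ a b c → a :* (b :* c) := (a :* c) :* (con 1ℚ :* b)) refl (ι 5) (recip (ι (j ℕ.* j))) (recip (ι 200)) ⟩
    recip (ι 40) * (ι 1 * recip (ι (j ℕ.* j)))      ∎
    where open ≡-Reasoning

  -- ∏ 1/(1 - uⱼ) ≤ 1/(1 - ∑ uⱼ), in the form ∏ rⱼ · (1 - ∑ uⱼ) ≤ 1 where rⱼ (1 - uⱼ) = 1 and rⱼ ≥ 1.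
  ∏headRatio*[1-∑headShare]≤1 : ∀ L → All (1 ℕ.≤_) L → ∏ headRatio L * (1ℚ - ∑ headShare L) ≤ 1ℚ
  ∏headRatio*[1-∑headShare]≤1 [] [] = ≤-reflexive refl
  ∏headRatio*[1-∑headShare]≤1 (j ∷ L) (1≤j ∷ 1≤L) = begin
    headRatio j * K * (1ℚ - (headShare j + S))
      ≡⟨ solve 5 (λ r k u s o → r :* k :* (o :- (u :+ s)) := k :* (r :* (o :- u) :- r :* s)) refl (headRatio j) K (headShare j) S 1ℚ ⟩
    K * (headRatio j * (1ℚ - headShare j) - headRatio j * S)
      ≡⟨ cong (λ z → K * (z - headRatio j * S)) (headRatio*[1-headShare]≡1 1≤j) ⟩
    K * (1ℚ - headRatio j * S)
      ≤⟨ *-monoˡ-≤-0≤ 0≤K (+-monoʳ-≤ 1ℚ (neg-antimono-≤ S≤rS)) ⟩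
    K * (1ℚ - S)
      ≤⟨ ∏headRatio*[1-∑headShare]≤1 L 1≤L ⟩
    1ℚ ∎
    where
    open ≤-Reasoning
    K : ℚ
    K = ∏ headRatio L
    S : ℚ
    S = ∑ headShare L
    0≤K : 0ℚ ≤ K
    0≤K = ∏-nonNeg headRatio L (λ i → /ℕ-nonNeg (farIdx i) ℕ.∣ 5 - farIdx i ∣)
    S≤rS : S ≤ headRatio j * S
    S≤rS = subst (_≤ headRatio j * S) (*-identityˡ S) (*-monoʳ-≤-0≤ (∑-nonNeg headShare L (λ i → /ℕ-nonNeg 5 (farIdx i))) (1≤headRatio 1≤j))

  1/20 : ℚ
  1/20 = recip (ι 40) * ι 2

  ∑headShare≤1/20 : ∀ D → ∑ headShare (countdown D) ≤ 1/20
  ∑headShare≤1/20 D = begin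
    ∑ headShare (countdown D)                                      ≡⟨ ∑-cong (countdown D) headShare≡ ⟩
    ∑ (λ j → recip (ι 40) * 1 /ℕ (j ℕ.* j)) (countdown D)          ≡⟨ ∑-*ˡ (recip (ι 40)) (λ j → 1 /ℕ (j ℕ.* j)) (countdown D) ⟩
    recip (ι 40) * ∑ (λ j → 1 /ℕ (j ℕ.* j)) (countdown D)          ≤⟨ *-monoˡ-≤-0≤ (recip-nonNeg (ι-nonNeg 40)) (∑1/j²≤2 D) ⟩
    1/20                                                           ∎
    where open ≤-Reasoning

  ∏headRatio≤ : ∀ D → ∏ headRatio (countdown D) ≤ recip (1ℚ - 1/20)
  ∏headRatio≤ D = ≤-recip (toWitness {a? = 0ℚ <? 1ℚ - 1/20} _) (begin
    K * (1ℚ - 1/20)                       ≤⟨ *-monoˡ-≤-0≤ 0≤K (+-monoʳ-≤ 1ℚ (neg-antimono-≤ (∑headShare≤1/20 D))) ⟩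
    K * (1ℚ - ∑ headShare (countdown D))  ≤⟨ ∏headRatio*[1-∑headShare]≤1 (countdown D) (All.map proj₁ (countdown-bounds D)) ⟩
    1ℚ                                    ∎)
    where
    open ≤-Reasoning
    K : ℚ
    K = ∏ headRatio (countdown D)
    0≤K : 0ℚ ≤ K
    0≤K = ∏-nonNeg headRatio (countdown D) (λ i → /ℕ-nonNeg (farIdx i) ℕ.∣ 5 - farIdx i ∣)

  5/∣farIdx-5∣≤ : ∀ {j} → 1 ℕ.≤ j → 5 /ℕ ℕ.∣ farIdx j - 5 ∣ ≤ 1 /ℕ (20 ℕ.* (j ℕ.* j))
  5/∣farIdx-5∣≤ {j} 1≤j = /ℕ-mono-≤ 5 ℕ.∣ farIdx j - 5 ∣ 1 (20 ℕ.* x) 0<gap (ℕₚ.≤-trans (s≤s z≤n) (ℕₚ.*-monoʳ-≤ 20 1≤x)) cross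
    where
    open ℕ-Solver.+-*-Solver using () renaming (solve to ℕ-solve; _:+_ to _⊕_; _:*_ to _⊗_; _:=_ to _≐_; con to ℕ-con)
    x : ℕ
    x = j ℕ.* j
    1≤x : 1 ℕ.≤ x
    1≤x = 1≤j*j 1≤j
    gap≡ : ℕ.∣ farIdx j - 5 ∣ ≡ farIdx j ℕ.∸ 5
    gap≡ = ℕₚ.m≤n⇒∣n-m∣≡n∸m (5≤farIdx 1≤j)
    100x+5≤farIdx : 100 ℕ.* x ℕ.+ 5 ℕ.≤ farIdx j
    100x+5≤farIdx = subst (100 ℕ.* x ℕ.+ 5 ℕ.≤_) (ℕ-solve 1 (λ x → ℕ-con 100 ⊗ x ⊕ ℕ-con 100 ⊗ x ≐ x ⊗ ℕ-con 200) refl x)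
      (ℕₚ.+-monoʳ-≤ (100 ℕ.* x) (ℕₚ.≤-trans (ℕₚ.m≤m+n 5 95) (ℕₚ.*-monoʳ-≤ 100 1≤x)))
    100x≤gap : 100 ℕ.* x ℕ.≤ ℕ.∣ farIdx j - 5 ∣
    100x≤gap = subst₂ ℕ._≤_ (ℕₚ.m+n∸n≡m (100 ℕ.* x) 5) (sym gap≡) (ℕₚ.∸-monoˡ-≤ 5 100x+5≤farIdx)
    0<gap : 0 ℕ.< ℕ.∣ farIdx j - 5 ∣
    0<gap = ℕₚ.≤-trans (ℕₚ.≤-trans (s≤s z≤n) (ℕₚ.*-monoʳ-≤ 100 1≤x)) 100x≤gap
    cross : 5 ℕ.* (20 ℕ.* x) ℕ.≤ 1 ℕ.* ℕ.∣ farIdx j - 5 ∣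
    cross = subst₂ ℕ._≤_ (ℕ-solve 1 (λ x → ℕ-con 100 ⊗ x ≐ ℕ-con 5 ⊗ (ℕ-con 20 ⊗ x)) refl x) (sym (ℕₚ.*-identityˡ _)) 100x≤gap

  farRatio≡ : ∀ j i → farIdx i /ℕ ℕ.∣ farIdx j - farIdx i ∣ ≡ (i ℕ.* i) /ℕ (ℕ.∣ j - i ∣ ℕ.* (j ℕ.+ i))
  farRatio≡ j i = begin
    ι (farIdx i) * recip (ι ℕ.∣ farIdx j - farIdx i ∣)
      ≡⟨ cong₂ (λ a b → a * recip b) (ι-* (i ℕ.* i) 200) (sym (ι-∣-∣ (farIdx j) (farIdx i))) ⟩
    ι (i ℕ.* i) * ι 200 * recip ∣ ι (farIdx j) - ι (farIdx i) ∣
      ≡⟨ cong (λ z → ι (i ℕ.* i) * ι 200 * recip ∣ z ∣) difference-of-squares ⟩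
    ι (i ℕ.* i) * ι 200 * recip ∣ (ι j - ι i) * (ι j + ι i) * ι 200 ∣
      ≡⟨ cong (λ z → ι (i ℕ.* i) * ι 200 * recip z) ∣gap∣≡ ⟩
    ι (i ℕ.* i) * ι 200 * recip (ι (ℕ.∣ j - i ∣ ℕ.* (j ℕ.+ i)) * ι 200)
      ≡⟨ cong (ι (i ℕ.* i) * ι 200 *_) (recip-* (ι (ℕ.∣ j - i ∣ ℕ.* (j ℕ.+ i))) (ι 200)) ⟩
    ι (i ℕ.* i) * ι 200 * (recip (ι (ℕ.∣ j - i ∣ ℕ.* (j ℕ.+ i))) * recip (ι 200))
      ≡⟨ solve 4 (λ a b c d → a :* b :* (c :* d) := (a :* c) :* (b :* d)) refl (ι (i ℕ.* i)) (ι 200) (recip (ι (ℕ.∣ j - i ∣ ℕ.* (j ℕ.+ i)))) (recip (ι 200)) ⟩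
    (i ℕ.* i) /ℕ (ℕ.∣ j - i ∣ ℕ.* (j ℕ.+ i)) * (ι 200 * recip (ι 200))
      ≡⟨ cong ((i ℕ.* i) /ℕ (ℕ.∣ j - i ∣ ℕ.* (j ℕ.+ i)) *_) (recip-inverseʳ (ι 200) (ι-suc≢0 199)) ⟩
    (i ℕ.* i) /ℕ (ℕ.∣ j - i ∣ ℕ.* (j ℕ.+ i)) * 1ℚ
      ≡⟨ *-identityʳ _ ⟩
    (i ℕ.* i) /ℕ (ℕ.∣ j - i ∣ ℕ.* (j ℕ.+ i)) ∎
    where
    open ≡-Reasoning
    ι-farIdx : ∀ k → ι (farIdx k) ≡ ι k * ι k * ι 200
    ι-farIdx k = trans (ι-* (k ℕ.* k) 200) (cong (_* ι 200) (ι-* k k))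
    difference-of-squares : ι (farIdx j) - ι (farIdx i) ≡ (ι j - ι i) * (ι j + ι i) * ι 200
    difference-of-squares = trans (cong₂ _-_ (ι-farIdx j) (ι-farIdx i))
      (solve 3 (λ a b c → a :* a :* c :- b :* b :* c := (a :- b) :* (a :+ b) :* c) refl (ι j) (ι i) (ι 200))
    ∣gap∣≡ : ∣ (ι j - ι i) * (ι j + ι i) * ι 200 ∣ ≡ ι (ℕ.∣ j - i ∣ ℕ.* (j ℕ.+ i)) * ι 200
    ∣gap∣≡ = trans (∣p*q∣≡∣p∣*∣q∣ ((ι j - ι i) * (ι j + ι i)) (ι 200))
      (cong (_* ι 200) (trans (∣p*q∣≡∣p∣*∣q∣ (ι j - ι i) (ι j + ι i))
        (trans (cong₂ _*_ (ι-∣-∣ j i) (trans (cong ∣_∣ (sym (ι-+ j i))) (0≤p⇒∣p∣≡p (ι-nonNeg (j ℕ.+ i)))))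
               (sym (ι-* ℕ.∣ j - i ∣ (j ℕ.+ i))))))

  ∏farRatio≤2 : ∀ j r → squares r ℕ.≤ 2 ℕ.* gaps j r → ∏ (λ i → farIdx i /ℕ ℕ.∣ farIdx j - farIdx i ∣) r ≤ ι 2
  ∏farRatio≤2 j r sq≤2gaps = begin
    ∏ (λ i → farIdx i /ℕ ℕ.∣ farIdx j - farIdx i ∣) r        ≡⟨ ∏-cong r (farRatio≡ j) ⟩
    ∏ (λ i → (i ℕ.* i) /ℕ (ℕ.∣ j - i ∣ ℕ.* (j ℕ.+ i))) r      ≡⟨ ∏-/ℕ (λ i → i ℕ.* i) (λ i → ℕ.∣ j - i ∣ ℕ.* (j ℕ.+ i)) r ⟩
    squares r /ℕ gaps j r                                    ≤⟨ bound (gaps j r) refl ⟩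
    ι 2                                                      ∎
    where
    open ≤-Reasoning
    bound : ∀ g → gaps j r ≡ g → squares r /ℕ gaps j r ≤ ι 2
    bound zero g≡0 = subst (_≤ ι 2) (sym (trans (cong (λ z → ι (squares r) * recip (ι z)) g≡0) (*-zeroʳ (ι (squares r))))) (ι-nonNeg 2)
    bound (suc g) g≡1+ = /ℕ-mono-≤ (squares r) (gaps j r) 2 1 (subst (0 ℕ.<_) (sym g≡1+) (s≤s z≤n)) (s≤s z≤n)
      (subst (ℕ._≤ 2 ℕ.* gaps j r) (sym (ℕₚ.*-identityʳ (squares r))) sq≤2gaps)

  κ : ℚ
  κ = ½ * recip (1ℚ - 1/20) + (oneThird + 1ℚ) * (2 /ℕ 20 * ι 2)

  -- Extrapolating P to 0 from the D + 1 nodes 5/m and 200j²/m (1 ≤ j ≤ D) yields |P 0| ≤ κ |P 0| with κ < 1.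
  module DualWitness {m D : ℕ} {P : ℚ → ℚ}
    (1≤D : 1 ℕ.≤ D) (farIdx[D]<m : farIdx D ℕ.< m) (deg : Degree≤ D P) (1≤∣P0∣ : 1ℚ ≤ ∣ P 0ℚ ∣)
    (∣P∣≤ : ∀ s → 0ℚ ≤ s → s ≤ 1ℚ → ∣ P s ∣ ≤ oneThird + powℚ (1ℚ - s) m * ∣ P 0ℚ ∣) where

    A : ℚ
    A = ∣ P 0ℚ ∣

    0≤A : 0ℚ ≤ A
    0≤A = 0≤∣p∣ (P 0ℚ)

    0<m : 0 ℕ.< m
    0<m = ℕₚ.≤-trans (s≤s z≤n) farIdx[D]<m

    node : ℕ → ℚ
    node t = t /ℕ m

    farIdx≤m : ∀ {j} → j ℕ.≤ D → farIdx j ℕ.≤ m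
    farIdx≤m j≤D = ℕₚ.<⇒≤ (ℕₚ.≤-<-trans (farIdx-mono-≤ j≤D) farIdx[D]<m)

    5≤m : 5 ℕ.≤ m
    5≤m = ℕₚ.≤-trans (5≤farIdx 1≤D) (farIdx≤m ℕₚ.≤-refl)

    node≢ : ∀ {a b} → a ℕ.< b → node a ≢ node b
    node≢ a<b = <⇒≢ (/ℕ-monoˡ-< m 0<m a<b)

    0≢node : ∀ {t} → 1 ℕ.≤ t → 0ℚ ≢ node t
    0≢node {t} 1≤t = <⇒≢ (subst (_< node t) (*-zeroˡ (recip (ι m))) (/ℕ-monoˡ-< m 0<m 1≤t))

    farNode : ℕ → ℚ
    farNode j = node (farIdx j)

    farNodes : List ℚ
    farNodes = map farNode (countdown D)

    nodes : List ℚ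
    nodes = node 5 ∷ farNodes

    unique-farNodes : ∀ D′ → Unique (map farNode (countdown D′))
    unique-farNodes zero = []
    unique-farNodes (suc D′) =
      map⁺ {f = farNode} (All.map (λ (_ , j≤D′) e → node≢ (farIdx-mono-< (s≤s j≤D′)) (sym e)) (countdown-bounds D′)) ∷ unique-farNodes D′

    unique-nodes : Unique (0ℚ ∷ nodes)
    unique-nodes =
      (0≢node {5} (s≤s z≤n) ∷ map⁺ {f = farNode} (All.map (λ (1≤j , _) → 0≢node (ℕₚ.≤-trans (s≤s z≤n) (5≤farIdx 1≤j))) (countdown-bounds D)))
      ∷ map⁺ {f = farNode} (All.map (λ (1≤j , _) → node≢ (ℕₚ.≤-trans (s≤s (ℕₚ.m≤m+n 5 194)) (200≤farIdx 1≤j))) (countdown-bounds D))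
      ∷ unique-farNodes D

    D+1≤|nodes| : suc D ℕ.≤ length nodes
    D+1≤|nodes| = ℕₚ.≤-reflexive (cong suc (sym (trans (length-map farNode (countdown D)) (length-countdown D))))

    ∣P-node∣≤ : ∀ t → t ℕ.≤ m → ∣ P (node t) ∣ ≤ oneThird + powℚ (1ℚ - node t) m * A
    ∣P-node∣≤ t t≤m = ∣P∣≤ (node t) (/ℕ-nonNeg t m) (/ℕ-≤1 t m 0<m t≤m)

    ⅓≤A*⅓ : oneThird ≤ A * oneThird
    ⅓≤A*⅓ = subst (_≤ A * oneThird) (*-identityˡ oneThird) (*-monoʳ-≤-0≤ (toWitness {a? = 0ℚ ≤? oneThird} _) 1≤∣P0∣)

    ∣P-far∣≤ : ∀ t → t ℕ.≤ m → ∣ P (node t) ∣ ≤ A * (oneThird + 1ℚ)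
    ∣P-far∣≤ t t≤m = begin
      ∣ P (node t) ∣                       ≤⟨ ∣P-node∣≤ t t≤m ⟩
      oneThird + powℚ (1ℚ - node t) m * A  ≤⟨ +-mono-≤ ⅓≤A*⅓ (subst (powℚ (1ℚ - node t) m * A ≤_) (*-comm 1ℚ A) (*-monoʳ-≤-0≤ 0≤A pow≤1)) ⟩
      A * oneThird + A * 1ℚ                ≡⟨ sym (*-distribˡ-+ A oneThird 1ℚ) ⟩
      A * (oneThird + 1ℚ)                  ∎
      where
      open ≤-Reasoning
      pow≤1 : powℚ (1ℚ - node t) m ≤ 1ℚ
      pow≤1 = powℚ-≤1 m (1ℚ - node t) (0≤q-p (/ℕ-≤1 t m 0<m t≤m)) (p-q≤p (/ℕ-nonNeg t m))

    -- Bernoulli with m · (5/m) = 5 gives (1 - 5/m)^m ≤ 1/6.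
    ∣P-head∣≤ : ∣ P (node 5) ∣ ≤ A * ½
    ∣P-head∣≤ = begin
      ∣ P (node 5) ∣                       ≤⟨ ∣P-node∣≤ 5 5≤m ⟩
      oneThird + powℚ (1ℚ - node 5) m * A  ≤⟨ +-mono-≤ ⅓≤A*⅓ (subst (powℚ (1ℚ - node 5) m * A ≤_) (*-comm (recip (ι 6)) A) (*-monoʳ-≤-0≤ 0≤A pow≤1/6)) ⟩
      A * oneThird + A * recip (ι 6)       ≡⟨ sym (*-distribˡ-+ A oneThird (recip (ι 6))) ⟩
      A * ½                                ∎
      where
      open ≤-Reasoning
      m*node5≡5 : ι m * node 5 ≡ ι 5
      m*node5≡5 = begin-equality
        ι m * (ι 5 * recip (ι m))     ≡⟨ solve 3 (λ a b c → a :* (b :* c) := b :* (a :* c)) refl (ι m) (ι 5) (recip (ι m)) ⟩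
        ι 5 * (ι m * recip (ι m))     ≡⟨ cong (ι 5 *_) (recip-inverseʳ (ι m) (0<⇒≢0 (<-≤-trans (ι-pos 0) (ι-mono-≤ 0<m)))) ⟩
        ι 5 * 1ℚ                      ≡⟨ *-identityʳ (ι 5) ⟩
        ι 5                           ∎
      pow≤1/6 : powℚ (1ℚ - node 5) m ≤ recip (ι 6)
      pow≤1/6 = ≤-recip (ι-pos 5) (subst (λ z → powℚ (1ℚ - node 5) m * (1ℚ + z) ≤ 1ℚ) m*node5≡5
        (bernoulli m (node 5) (/ℕ-nonNeg 5 m) (/ℕ-≤1 5 m 0<m 5≤m)))

    weighted : ℚ × List ℚ → ℚ
    weighted (x , others) = ∣ P x ∣ * lagrangeWeight x others

    head≤ : weighted (node 5 , farNodes) ≤ A * ½ * recip (1ℚ - 1/20)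
    head≤ = begin
      ∣ P (node 5) ∣ * lagrangeWeight (node 5) farNodes  ≡⟨ cong (∣ P (node 5) ∣ *_) (lagrangeWeight-/ℕ m 5 farIdx (countdown D) 0<m) ⟩
      ∣ P (node 5) ∣ * ∏ headRatio (countdown D)         ≤⟨ *-mono-≤-0≤ (0≤∣p∣ (P (node 5))) 0≤∏ ∣P-head∣≤ (∏headRatio≤ D) ⟩
      A * ½ * recip (1ℚ - 1/20)                          ∎
      where
      open ≤-Reasoning
      0≤∏ : 0ℚ ≤ ∏ headRatio (countdown D)
      0≤∏ = ∏-nonNeg headRatio (countdown D) (λ i → /ℕ-nonNeg (farIdx i) ℕ.∣ 5 - farIdx i ∣)

    farBound : ℕ → ℚ
    farBound j = A * (oneThird + 1ℚ) * (1 /ℕ (20 ℕ.* (j ℕ.* j)) * ι 2)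

    far≤ : ∀ j r → 1 ℕ.≤ j → j ℕ.≤ D → squares r ℕ.≤ 2 ℕ.* gaps j r →
           weighted (map₂ (node 5 ∷_) (farNode j , map farNode r)) ≤ farBound j
    far≤ j r 1≤j j≤D sq≤2gaps = begin
      ∣ P (farNode j) ∣ * ((∣ node 5 ∣ * recip ∣ farNode j - node 5 ∣) * lagrangeWeight (farNode j) (map farNode r))
        ≡⟨ cong₂ (λ a b → ∣ P (farNode j) ∣ * (a * b)) (∣a/m∣/∣b/m-a/m∣ m 5 (farIdx j) 0<m) (lagrangeWeight-/ℕ m (farIdx j) farIdx r 0<m) ⟩
      ∣ P (farNode j) ∣ * (5 /ℕ ℕ.∣ farIdx j - 5 ∣ * Π)
        ≤⟨ *-mono-≤-0≤ (0≤∣p∣ (P (farNode j))) (0≤* (/ℕ-nonNeg 5 ℕ.∣ farIdx j - 5 ∣) 0≤Π) (∣P-far∣≤ (farIdx j) (farIdx≤m j≤D))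
             (*-mono-≤-0≤ (/ℕ-nonNeg 5 ℕ.∣ farIdx j - 5 ∣) 0≤Π (5/∣farIdx-5∣≤ 1≤j) (∏farRatio≤2 j r sq≤2gaps)) ⟩
      farBound j ∎
      where
      open ≤-Reasoning
      Π : ℚ
      Π = ∏ (λ i → farIdx i /ℕ ℕ.∣ farIdx j - farIdx i ∣) r
      0≤Π : 0ℚ ≤ Π
      0≤Π = ∏-nonNeg (λ i → farIdx i /ℕ ℕ.∣ farIdx j - farIdx i ∣) r (λ i → /ℕ-nonNeg (farIdx i) ℕ.∣ farIdx j - farIdx i ∣)

    ∑far≤ : ∑ weighted (map (map₂ (node 5 ∷_)) (select farNodes)) ≤ A * (oneThird + 1ℚ) * (2 /ℕ 20 * ι 2)
    ∑far≤ = begin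
      ∑ weighted (map (map₂ (node 5 ∷_)) (select farNodes))
        ≡⟨ cong (λ ps → ∑ weighted (map (map₂ (node 5 ∷_)) ps)) (select-map farNode (countdown D)) ⟩
      ∑ weighted (map (map₂ (node 5 ∷_)) (map G (select (countdown D))))
        ≡⟨ trans (∑-map weighted (map₂ (node 5 ∷_)) (map G (select (countdown D)))) (∑-map (λ q → weighted (map₂ (node 5 ∷_) q)) G (select (countdown D))) ⟩
      ∑ (λ p → weighted (map₂ (node 5 ∷_) (G p))) (select (countdown D))
        ≤⟨ ∑-monoᴬ (All.zipWith (λ { {j , r} ((1≤j , j≤D) , sq≤2gaps) → far≤ j r 1≤j j≤D sq≤2gaps })
                     (All-select (countdown-bounds D) , squares≤2*gaps D)) ⟩
      ∑ (λ p → farBound (proj₁ p)) (select (countdown D))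
        ≡⟨ ∑-select farBound (countdown D) ⟩
      ∑ farBound (countdown D)
        ≡⟨ ∑-cong (countdown D) (λ j → cong (A * (oneThird + 1ℚ) *_) (regroup j)) ⟩
      ∑ (λ j → A * (oneThird + 1ℚ) * (2 /ℕ 20 * 1 /ℕ (j ℕ.* j))) (countdown D)
        ≡⟨ trans (∑-*ˡ (A * (oneThird + 1ℚ)) (λ j → 2 /ℕ 20 * 1 /ℕ (j ℕ.* j)) (countdown D)) (cong (A * (oneThird + 1ℚ) *_) (∑-*ˡ (2 /ℕ 20) (λ j → 1 /ℕ (j ℕ.* j)) (countdown D))) ⟩
      A * (oneThird + 1ℚ) * (2 /ℕ 20 * ∑ (λ j → 1 /ℕ (j ℕ.* j)) (countdown D))
        ≤⟨ *-monoˡ-≤-0≤ (0≤* 0≤A (toWitness {a? = 0ℚ ≤? oneThird + 1ℚ} _)) (*-monoˡ-≤-0≤ (/ℕ-nonNeg 2 20) (∑1/j²≤2 D)) ⟩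
      A * (oneThird + 1ℚ) * (2 /ℕ 20 * ι 2) ∎
      where
      open ≤-Reasoning
      G : ℕ × List ℕ → ℚ × List ℚ
      G (j , r) = farNode j , map farNode r
      regroup : ∀ j → 1 /ℕ (20 ℕ.* (j ℕ.* j)) * ι 2 ≡ 2 /ℕ 20 * 1 /ℕ (j ℕ.* j)
      regroup j = begin-equality
        ι 1 * recip (ι (20 ℕ.* (j ℕ.* j))) * ι 2
          ≡⟨ cong (λ z → ι 1 * z * ι 2) (trans (cong recip (ι-* 20 (j ℕ.* j))) (recip-* (ι 20) (ι (j ℕ.* j)))) ⟩
        ι 1 * (recip (ι 20) * recip (ι (j ℕ.* j))) * ι 2
          ≡⟨ solve 4 (λ o a b t → o :* (a :* b) :* t := t :* a :* (o :* b)) refl (ι 1) (recip (ι 20)) (recip (ι (j ℕ.* j))) (ι 2) ⟩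
        2 /ℕ 20 * 1 /ℕ (j ℕ.* j) ∎

    A≤κA : A ≤ A * κ
    A≤κA = begin
      A                       ≤⟨ extrapolation deg nodes unique-nodes D+1≤|nodes| ⟩
      ∑ weighted (select nodes)
                              ≤⟨ +-mono-≤ head≤ ∑far≤ ⟩
      A * ½ * recip (1ℚ - 1/20) + A * (oneThird + 1ℚ) * (2 /ℕ 20 * ι 2)
                              ≡⟨ solve 5 (λ a h i t k → a :* h :* i :+ a :* t :* k := a :* (h :* i :+ t :* k)) refl A ½ (recip (1ℚ - 1/20)) (oneThird + 1ℚ) (2 /ℕ 20 * ι 2) ⟩
      A * κ                   ∎
      where open ≤-Reasoning

    contradiction : ⊥
    contradiction = <-irrefl refl (<-≤-trans (toWitness {a? = κ <? 1ℚ} _)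
      (*-cancelˡ-≤-pos A {{positive (<-≤-trans 0<1 1≤∣P0∣)}} (subst (_≤ A * κ) (sym (*-identityʳ A)) A≤κA)))

  origin-detector-degree : ∀ m d (H : Vec Bool m → ℚ) → CubeDegree≤ m d H → 1ℚ ≤ ∣ H (replicate m false) ∣ →
    (∀ z → z ≢ replicate m false → ∣ H z ∣ ≤ oneThird) → m ℕ.≤ d ℕ.* d ℕ.* 200
  origin-detector-degree zero d H deg 1≤∣H0∣ ∣H∣≤ = z≤n
  origin-detector-degree (suc m) d H deg 1≤∣H0∣ ∣H∣≤ with suc m ℕ.≤? farIdx d
  ... | yes m≤ = m≤
  ... | no m≰ = ⊥-elim (impossible d deg (ℕₚ.≰⇒> m≰))
    where
    impossible : ∀ d → CubeDegree≤ (suc m) d H → farIdx d ℕ.< suc m → ⊥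
    impossible zero (constant c H≗c) _ = <-irrefl refl (<-≤-trans (toWitness {a? = oneThird <? 1ℚ} _) (begin
      1ℚ                                  ≤⟨ 1≤∣H0∣ ⟩
      ∣ H (replicate (suc m) false) ∣      ≡⟨ cong ∣_∣ (trans (H≗c _) (sym (H≗c e₁))) ⟩
      ∣ H e₁ ∣                             ≤⟨ ∣H∣≤ e₁ (λ ()) ⟩
      oneThird                            ∎))
      where
      open ≤-Reasoning
      e₁ : Vec Bool (suc m)
      e₁ = true ∷ replicate m false
    impossible (suc d) deg farIdx<m = DualWitness.contradiction {P = λ s → 𝔼 s H} (s≤s z≤n) farIdx<m (𝔼-degree deg)
      (subst (λ c → 1ℚ ≤ ∣ c ∣) (sym (𝔼-at-0 H)) 1≤∣H0∣)
      (λ s 0≤s s≤1 → subst (λ c → ∣ 𝔼 s H ∣ ≤ oneThird + powℚ (1ℚ - s) (suc m) * ∣ c ∣) (sym (𝔼-at-0 H))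
        (∣𝔼∣≤-origin s H oneThird (toWitness {a? = 0ℚ ≤? oneThird} _) 0≤s s≤1 ∣H∣≤))


module DNFProperties where

  open import Data.Nat as ℕ using (ℕ; zero; suc; _≤_; z≤n; s≤s)
  open import Data.Nat.Properties using (≤-trans; m≤m⊔n; m≤n⊔m)
  open import Data.Bool using (Bool; true; false; _∧_; _∨_; not)
  open import Data.Bool.Properties using (∨-zeroʳ; ∨-conicalʳ; ∧-conicalˡ; ∧-conicalʳ; not-injective)
  open import Data.Fin using (Fin; zero; suc)
  open import Data.Fin.Properties using (_≟_)
  open import Data.List using ([]; _∷_; length; lookup; removeAt; _[_]∷=_)
  open import Data.List.Relation.Unary.All as All using (All; []; _∷_)
  open import Data.List.Relation.Unary.Any using (here; there; index)
  open import Data.List.Relation.Unary.Any.Properties using (lookup-index)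
  open import Data.List.Membership.Propositional using (_∈_)
  open import Data.Product using (Σ-syntax; _,_; proj₁; proj₂)
  open import Data.Sum using (_⊎_; inj₁; inj₂)
  open import Data.Empty using (⊥-elim)
  open import Function using (_∘_)
  open import Relation.Nullary using (yes; no; does)
  open import Relation.Binary.PropositionalEquality
  open import Defs

  Congruent≗ : ∀ {n} → (Input n → Bool) → Set
  Congruent≗ {n} P = ∀ {x y : Input n} → x ≗ y → P x ≡ P y

  _◃_ : ∀ {n} → Bool → Input n → Input (suc n)
  (b ◃ x) zero = b
  (b ◃ x) (suc i) = x i

  cube-search : ∀ n (P : Input n → Bool) → Congruent≗ P → (Σ[ x ∈ Input n ] P x ≡ true) ⊎ (∀ x → P x ≡ false)
  cube-search zero P P-cong with P (λ ()) in Px₀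
  ... | true = inj₁ ((λ ()) , Px₀)
  ... | false = inj₂ (λ x → trans (P-cong (λ ())) Px₀)
  cube-search (suc n) P P-cong
    with cube-search n (λ x → P (false ◃ x)) (λ x≗y → P-cong (λ { zero → refl ; (suc i) → x≗y i }))
       | cube-search n (λ x → P (true ◃ x)) (λ x≗y → P-cong (λ { zero → refl ; (suc i) → x≗y i }))
  ... | inj₁ (x , Px) | _ = inj₁ (false ◃ x , Px)
  ... | inj₂ _ | inj₁ (x , Px) = inj₁ (true ◃ x , Px)
  ... | inj₂ P₀≡false | inj₂ P₁≡false = inj₂ (λ x → trans (P-cong (λ { zero → refl ; (suc i) → refl })) (by-head (x zero) (λ i → x (suc i))))
    where
    by-head : ∀ b x → P (b ◃ x) ≡ false
    by-head false = P₀≡false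
    by-head true = P₁≡false

  evalLit-cong : ∀ {n} (l : Literal n) → Congruent≗ (evalLit l)
  evalLit-cong (i , true) x≗y = x≗y i
  evalLit-cong (i , false) x≗y = cong not (x≗y i)

  evalTerm-cong : ∀ {n} (t : Term n) → Congruent≗ (evalTerm t)
  evalTerm-cong [] _ = refl
  evalTerm-cong (l ∷ t) x≗y = cong₂ _∧_ (evalLit-cong l x≗y) (evalTerm-cong t x≗y)

  evalDNF-cong : ∀ {n} (F : DNF n) → Congruent≗ (evalDNF F)
  evalDNF-cong [] _ = refl
  evalDNF-cong (t ∷ F) x≗y = cong₂ _∨_ (evalTerm-cong t x≗y) (evalDNF-cong F x≗y)

  occurs-head : ∀ {n} (i : Fin n) b t → occurs i ((i , b) ∷ t) ≡ true
  occurs-head i b t with i ≟ i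
  ... | yes _ = refl
  ... | no i≢i = ⊥-elim (i≢i refl)

  evalTerm-local : ∀ {n} (t : Term n) x y → (∀ v → occurs v t ≡ true → x v ≡ y v) → evalTerm t x ≡ evalTerm t y
  evalTerm-local [] x y _ = refl
  evalTerm-local ((i , b) ∷ t) x y agree = cong₂ _∧_ (literal b)
    (evalTerm-local t x y (λ v v∈t → agree v (trans (cong (does (v ≟ i) ∨_) v∈t) (∨-zeroʳ _))))
    where
    xᵢ≡yᵢ : x i ≡ y i
    xᵢ≡yᵢ = agree i (occurs-head i b t)
    literal : ∀ b → evalLit (i , b) x ≡ evalLit (i , b) y
    literal true = xᵢ≡yᵢ
    literal false = cong not xᵢ≡yᵢ

  evalDNF-removeAt : ∀ {n} (F : DNF n) j x → evalTerm (lookup F j) x ≡ false → evalDNF (removeAt F j) x ≡ evalDNF F x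
  evalDNF-removeAt (t ∷ F) zero x tx≡false = sym (cong (_∨ evalDNF F x) tx≡false)
  evalDNF-removeAt (t ∷ F) (suc j) x tx≡false = cong (evalTerm t x ∨_) (evalDNF-removeAt F j x tx≡false)

  evalTerm-removeAt : ∀ {n} (t : Term n) l x → evalTerm t x ≡ true → evalTerm (removeAt t l) x ≡ true
  evalTerm-removeAt (a ∷ t) zero x e = ∧-conicalʳ (evalLit a x) _ e
  evalTerm-removeAt (a ∷ t) (suc l) x e = cong₂ _∧_ (∧-conicalˡ (evalLit a x) _ e) (evalTerm-removeAt t l x (∧-conicalʳ (evalLit a x) _ e))

  ∨-true : ∀ {a b} → a ∨ b ≡ true → a ≡ true ⊎ b ≡ true
  ∨-true {true} _ = inj₁ refl
  ∨-true {false} e = inj₂ e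

  evalDNF-update-mono : ∀ {n} (F : DNF n) j t′ x → (evalTerm (lookup F j) x ≡ true → evalTerm t′ x ≡ true) →
    evalDNF F x ≡ true → evalDNF (F [ j ]∷= t′) x ≡ true
  evalDNF-update-mono (t ∷ F) zero t′ x t⇒t′ e with ∨-true {evalTerm t x} e
  ... | inj₁ tx = cong (_∨ evalDNF F x) (t⇒t′ tx)
  ... | inj₂ Fx = trans (cong (evalTerm t′ x ∨_) Fx) (∨-zeroʳ _)
  evalDNF-update-mono (t ∷ F) (suc j) t′ x t⇒t′ e with ∨-true {evalTerm t x} e
  ... | inj₁ tx = cong (_∨ evalDNF (F [ j ]∷= t′) x) tx
  ... | inj₂ Fx = trans (cong (evalTerm t x ∨_) (evalDNF-update-mono F j t′ x t⇒t′ Fx)) (∨-zeroʳ _)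

  evalDNF-∈ : ∀ {n} {t : Term n} {F : DNF n} x → t ∈ F → evalTerm t x ≡ true → evalDNF F x ≡ true
  evalDNF-∈ {F = u ∷ F} x (here refl) e = cong (_∨ evalDNF F x) e
  evalDNF-∈ {F = u ∷ F} x (there t∈F) e = trans (cong (evalTerm u x ∨_) (evalDNF-∈ x t∈F e)) (∨-zeroʳ _)

  some-literal : ∀ {n} (F : DNF n) → 1 ℕ.≤ maxWidth F → Σ[ j ∈ Fin (length F) ] Fin (length (lookup F j))
  some-literal ((_ ∷ _) ∷ F) _ = zero , zero
  some-literal ([] ∷ F) 1≤w = let (j , l) = some-literal F 1≤w in suc j , l

  -- If F were constantly true, dropping any literal (which only enlarges its term) would not change it.
  minimal⇒falsifiable : ∀ {n} (F : DNF n) → Minimal F → 1 ℕ.≤ maxWidth F → Σ[ x ∈ Input n ] evalDNF F x ≡ false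
  minimal⇒falsifiable {n} F (_ , literals-needed) 1≤w with cube-search n (λ x → not (evalDNF F x)) (cong not ∘ evalDNF-cong F)
  ... | inj₁ (x , ¬Fx) = x , not-injective ¬Fx
  ... | inj₂ F≡true = ⊥-elim (literals-needed j l same)
    where
    j : Fin (length F)
    j = proj₁ (some-literal F 1≤w)
    l : Fin (length (lookup F j))
    l = proj₂ (some-literal F 1≤w)
    same : SameFunction (F [ j ]∷= removeAt (lookup F j) l) F
    same x = trans
      (evalDNF-update-mono F j (removeAt (lookup F j) l) x (evalTerm-removeAt (lookup F j) l x) (not-injective (F≡true x)))
      (sym (not-injective (F≡true x)))

  minimal⇒satisfiable : ∀ {n} (F : DNF n) → Minimal F → ∀ {t} → t ∈ F → Σ[ y ∈ Input n ] evalTerm t y ≡ true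
  minimal⇒satisfiable {n} F (terms-needed , _) {t} t∈F with cube-search n (evalTerm t) (evalTerm-cong t)
  ... | inj₁ sat = sat
  ... | inj₂ t≡false = ⊥-elim (terms-needed (index t∈F)
    (λ x → evalDNF-removeAt F (index t∈F) x (trans (cong (λ u → evalTerm u x) (sym (lookup-index t∈F))) (t≡false x))))

  length≤maxWidth : ∀ {n} (F : DNF n) → All (λ t → length t ≤ maxWidth F) F
  length≤maxWidth [] = []
  length≤maxWidth (t ∷ F) = m≤m⊔n (length t) (maxWidth F) ∷ All.map (λ le → ≤-trans le (m≤n⊔m (length t) (maxWidth F))) (length≤maxWidth F)

  falsifiable⇒terms-nonempty : ∀ {n} (F : DNF n) x → evalDNF F x ≡ false → All (λ t → 1 ≤ length t) F
  falsifiable⇒terms-nonempty [] x _ = []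
  falsifiable⇒terms-nonempty ([] ∷ F) x ()
  falsifiable⇒terms-nonempty ((l ∷ t) ∷ F) x Fx≡false = s≤s z≤n ∷ falsifiable⇒terms-nonempty F x (∨-conicalʳ (evalTerm (l ∷ t) x) _ Fx≡false)



module Counting where

  open import Data.Nat using (ℕ; suc; _+_; _≤_; z≤n; s≤s)
  open import Data.Nat.Properties using (≤-refl; ≤-trans; +-suc; +-monoʳ-≤; n≤1+n)
  open import Data.Bool using (Bool; true; false; _∨_; not)
  open import Data.List using (List; []; _∷_; length; filter)
  open import Relation.Nullary.Decidable using (T?)
  open import Relation.Binary.PropositionalEquality

  private variable A : Set

  count : (A → Bool) → List A → ℕ
  count q L = length (filter (λ u → T? (q u)) L)

  count-split : ∀ (q : A → Bool) L → length L ≡ count q L + count (λ u → not (q u)) L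
  count-split q [] = refl
  count-split q (x ∷ L) with q x
  ... | true = cong suc (count-split q L)
  ... | false = trans (cong suc (count-split q L)) (sym (+-suc _ _))

  count-∷-true : ∀ (q : A → Bool) {x} L → q x ≡ true → count q (x ∷ L) ≡ suc (count q L)
  count-∷-true q L qx≡true rewrite qx≡true = refl

  count-∷ : ∀ (q : A → Bool) x L → count q L ≤ count q (x ∷ L)
  count-∷ q x L with q x
  ... | true = n≤1+n _
  ... | false = ≤-refl

  count-∨ : ∀ (a b : A → Bool) L → count (λ u → a u ∨ b u) L ≤ count a L + count b L
  count-∨ a b [] = z≤n
  count-∨ a b (x ∷ L) with a x
  ... | true = s≤s (≤-trans (count-∨ a b L) (+-monoʳ-≤ (count a L) (count-∷ b x L)))
  ... | false with b x
  ...   | true = subst (suc (count (λ u → a u ∨ b u) L) ≤_) (sym (+-suc _ _)) (s≤s (count-∨ a b L))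
  ...   | false = count-∨ a b L

  count-filter : ∀ (p q : A → Bool) L → count p (filter (λ u → T? (q u)) L) ≤ count p L
  count-filter p q [] = z≤n
  count-filter p q (x ∷ L) with q x
  ... | false = ≤-trans (count-filter p q L) (count-∷ p x L)
  ... | true with p x
  ...   | true = s≤s (count-filter p q L)
  ...   | false = count-filter p q L

  count-false : ∀ (L : List A) → count (λ _ → false) L ≡ 0
  count-false [] = refl
  count-false (x ∷ L) = count-false L


module DisjointTerms where

  open import Data.Nat using (ℕ; zero; suc; _+_; _*_; _≤_; z≤n; s≤s)
  open import Data.Nat.Properties using (≤-reflexive; ≤-trans; +-mono-≤; *-monoˡ-≤; module ≤-Reasoning)
  open import Data.Nat.Solver using (module +-*-Solver)
  open import Data.Bool using (Bool; true; false; _∨_; not)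
  open import Data.Bool.Properties using (∨-conicalˡ; ∨-conicalʳ; T-not-≡)
  open import Data.Bool.ListAction using (any)
  open import Data.Fin.Properties using (_≟_)
  open import Data.List using ([]; _∷_; length; filter)
  open import Data.List.Properties using (length-filter)
  open import Data.List.Relation.Unary.All as All using (All; []; _∷_)
  open import Data.List.Relation.Unary.All.Properties using (all-filter; filter⁺)
  open import Data.List.Relation.Unary.AllPairs using (AllPairs; []; _∷_)
  open import Data.Product using (_,_; proj₁)
  open import Function using (Equivalence)
  open import Relation.Nullary using (yes; no)
  open import Relation.Nullary.Decidable using (T?)
  open import Relation.Binary.PropositionalEquality
  open +-*-Solver
  open import Defs
  open DNFProperties using (occurs-head)
  open Counting

  module _ {n : ℕ} where

    shares : Term n → Term n → Bool
    shares t u = any (λ l → occurs (proj₁ l) u) t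

    Disjoint : DNF n → Set
    Disjoint = AllPairs (λ t u → shares t u ≡ false)

    -- The fuel f only ensures termination; f ≥ length L makes it irrelevant.
    greedy : ℕ → DNF n → DNF n
    greedy zero L = []
    greedy (suc f) [] = []
    greedy (suc f) (t ∷ L) = t ∷ greedy f (filter (λ u → T? (not (shares t u))) L)

    greedy⁺ : ∀ {P : Term n → Set} f {L} → All P L → All P (greedy f L)
    greedy⁺ zero _ = []
    greedy⁺ (suc f) [] = []
    greedy⁺ (suc f) (pt ∷ pL) = pt ∷ greedy⁺ f (filter⁺ _ pL)

    greedy-disjoint : ∀ f L → Disjoint (greedy f L)
    greedy-disjoint zero L = []
    greedy-disjoint (suc f) [] = []
    greedy-disjoint (suc f) (t ∷ L) =
      greedy⁺ f (All.map (Equivalence.to T-not-≡) (all-filter (λ u → T? (not (shares t u))) L))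
      ∷ greedy-disjoint f (filter (λ u → T? (not (shares t u))) L)

    ReadKList : ℕ → DNF n → Set
    ReadKList k L = ∀ i → count (occurs i) L ≤ k

    count-shares : ∀ k t L → ReadKList k L → count (shares t) L ≤ length t * k
    count-shares k [] L _ = ≤-reflexive (count-false L)
    count-shares k (l ∷ t) L read-k = ≤-trans (count-∨ (occurs (proj₁ l)) (shares t) L) (+-mono-≤ (read-k (proj₁ l)) (count-shares k t L read-k))

    shares-self : ∀ t → 1 ≤ length t → shares t t ≡ true
    shares-self ((i , b) ∷ t) _ = cong (λ z → z ∨ shares t ((i , b) ∷ t)) (occurs-head i b t)

    shares-false⇒disjoint : ∀ t u v → shares t u ≡ false → occurs v t ≡ true → occurs v u ≡ false
    shares-false⇒disjoint ((i , b) ∷ t) u v t∩u≡∅ v∈t with v ≟ i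
    ... | yes refl = ∨-conicalˡ (occurs v u) _ t∩u≡∅
    ... | no _ = shares-false⇒disjoint t u v (∨-conicalʳ (occurs i u) _ t∩u≡∅) v∈t

    -- Each chosen term t discards only terms sharing a variable with it: at most |t|·k ≤ w·k of them.
    greedy-size : ∀ k w f L → length L ≤ f → ReadKList k L → All (λ t → 1 ≤ length t) L → All (λ t → length t ≤ w) L →
      length L ≤ w * k * length (greedy f L)
    greedy-size k w zero [] _ _ _ _ = z≤n
    greedy-size k w (suc f) [] _ _ _ _ = z≤n
    greedy-size k w (suc f) (t ∷ L) (s≤s |L|≤f) read-k (1≤|t| ∷ 1≤|L|) (|t|≤w ∷ |L|≤w) = begin
      suc (length L)                                  ≡⟨ cong suc (count-split (shares t) L) ⟩
      suc (count (shares t) L + length L′)            ≡⟨ cong (_+ length L′) (sym (count-∷-true (shares t) L (shares-self t 1≤|t|))) ⟩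
      count (shares t) (t ∷ L) + length L′            ≤⟨ +-mono-≤ (≤-trans (count-shares k t (t ∷ L) read-k) (*-monoˡ-≤ k |t|≤w)) ih ⟩
      w * k + w * k * length (greedy f L′)            ≡⟨ solve 3 (λ w k g → w :* k :+ w :* k :* g := w :* k :* (con 1 :+ g)) refl w k (length (greedy f L′)) ⟩
      w * k * suc (length (greedy f L′))              ∎
      where
      open ≤-Reasoning
      L′ : DNF n
      L′ = filter (λ u → T? (not (shares t u))) L
      ih : length L′ ≤ w * k * length (greedy f L′)
      ih = greedy-size k w f L′ (≤-trans (length-filter _ L) |L|≤f)
        (λ i → ≤-trans (count-filter (occurs i) (λ u → not (shares t u)) L) (≤-trans (count-∷ (occurs i) t L) (read-k i)))
        (filter⁺ _ 1≤|L|) (filter⁺ _ |L|≤w)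


module Restriction where

  open import Data.Nat using (_*_; _≤_)
  open import Data.Bool using (Bool; true; false; _∧_; not; if_then_else_)
  open import Data.Bool.Properties using (∧-zeroʳ)
  open import Data.Fin using (zero; suc)
  open import Data.List using ([]; _∷_; length)
  open import Data.List.Relation.Unary.All as All using (All; []; _∷_)
  open import Data.List.Relation.Unary.AllPairs using ([]; _∷_)
  open import Data.List.Membership.Propositional using (_∈_)
  open import Data.Vec using (Vec; []; _∷_; replicate)
  open import Data.Product using (Σ-syntax; _,_; proj₁; proj₂)
  open import Data.Sum using (inj₁; inj₂)
  open import Data.Empty using (⊥-elim)
  open import Function using (_∘_)
  open import Relation.Binary.PropositionalEquality
  open import Defs
  open DNFProperties using (evalTerm-local; evalDNF-∈; evalDNF-cong)
  open DisjointTerms using (Disjoint; shares-false⇒disjoint)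
  open Substitution using (Coordinates1Junta; evalPoly-degree)
  open OrLowerBound using (origin-detector-degree)

  Satisfiable : ∀ {n} → Term n → Set
  Satisfiable {n} t = Σ[ y ∈ Input n ] evalTerm t y ≡ true

  module _ {n} (x₀ : Input n) where

    plant : (S : DNF n) → All Satisfiable S → Vec Bool (length S) → Input n
    plant [] [] [] v = x₀ v
    plant (t ∷ S) ((y , _) ∷ W) (b ∷ z) v = if b ∧ occurs v t then y v else plant S W z v

    plant-origin : ∀ S W → plant S W (replicate (length S) false) ≗ x₀
    plant-origin [] [] v = refl
    plant-origin (t ∷ S) (_ ∷ W) v = plant-origin S W v

    plant-satisfies : ∀ (F : DNF n) S W → All (_∈ F) S → ∀ z → z ≢ replicate (length S) false → evalDNF F (plant S W z) ≡ true
    plant-satisfies F [] [] [] [] []≢[] = ⊥-elim ([]≢[] refl)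
    plant-satisfies F (t ∷ S) ((y , ty) ∷ W) (t∈F ∷ _) (true ∷ z) _ =
      evalDNF-∈ _ t∈F (trans (evalTerm-local t _ y agree) ty)
      where
      agree : ∀ v → occurs v t ≡ true → plant (t ∷ S) ((y , ty) ∷ W) (true ∷ z) v ≡ y v
      agree v v∈t rewrite v∈t = refl
    plant-satisfies F (t ∷ S) (_ ∷ W) (_ ∷ S⊆F) (false ∷ z) z≢0 = plant-satisfies F S W S⊆F z (z≢0 ∘ cong (false ∷_))

    plant-untouched : ∀ S W v → All (λ u → occurs v u ≡ false) S → ∀ z → plant S W z v ≡ x₀ v
    plant-untouched [] [] v [] [] = refl
    plant-untouched (t ∷ S) ((y , _) ∷ W) v (v∉t ∷ v∉S) (b ∷ z) rewrite v∉t | ∧-zeroʳ b = plant-untouched S W v v∉S z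

    plant-1junta : ∀ S W → Disjoint S → Coordinates1Junta (plant S W)
    plant-1junta [] [] [] v = inj₁ (x₀ v , λ { [] → refl })
    plant-1junta (t ∷ S) ((y , ty) ∷ W) (t∩S≡∅ ∷ disjoint) v with occurs v t in v∈t
    ... | true = inj₂ (zero , y v , x₀ v , λ { (true ∷ z) → on z ; (false ∷ z) → plant-untouched S W v v∉S z })
      where
      v∉S : All (λ u → occurs v u ≡ false) S
      v∉S = All.map (λ {u} t∩u≡∅ → shares-false⇒disjoint t u v t∩u≡∅ v∈t) t∩S≡∅
      on : ∀ z → plant (t ∷ S) ((y , ty) ∷ W) (true ∷ z) v ≡ y v
      on z rewrite v∈t = refl
    ... | false with plant-1junta S W disjoint v
    ...   | inj₁ (B , const) = inj₁ (B , λ { (b ∷ z) → trans (skip b z) (const z) })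
      where
      skip : ∀ b z → plant (t ∷ S) ((y , ty) ∷ W) (b ∷ z) v ≡ plant S W z v
      skip true z rewrite v∈t = refl
      skip false z = refl
    ...   | inj₂ (i , A , B , dict) = inj₂ (suc i , A , B , λ { (b ∷ z) → trans (skip b z) (dict z) })
      where
      skip : ∀ b z → plant (t ∷ S) ((y , ty) ∷ W) (b ∷ z) v ≡ plant S W z v
      skip true z rewrite v∈t = refl
      skip false z = refl


  disjoint-terms≤200deg² : ∀ {n} (F : DNF n) (p : Poly n) → NApprox p (λ x → not (evalDNF F x)) →
    ∀ x₀ → evalDNF F x₀ ≡ false → ∀ S → All (_∈ F) S → (W : All Satisfiable S) → Disjoint S →
    length S ≤ degree p * degree p * 200
  disjoint-terms≤200deg² F p approx x₀ Fx₀≡false S S⊆F W disjoint =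
    origin-detector-degree (length S) (degree p) (λ z → evalPoly p (plant x₀ S W z))
      (evalPoly-degree (plant x₀ S W) (plant-1junta x₀ S W disjoint) p)
      (proj₂ (approx _) (cong not (trans (evalDNF-cong F (plant-origin x₀ S W)) Fx₀≡false)))
      (λ z z≢0 → proj₁ (approx _) (cong not (plant-satisfies x₀ F S W S⊆F z z≢0)))

open import Defs
open import Data.Nat using (ℕ; _*_; _≤_)
open import Data.Bool using (not)
open import Data.Product using (Σ; _,_)
open import Data.List using (length)
open import Data.List.Relation.Unary.All as All using (All)
open import Data.Nat.Properties using (≤-refl; *-monoʳ-≤; module ≤-Reasoning)
open import Data.Nat.Solver using (module +-*-Solver)
open import Function using (id)
open import Data.List.Membership.Propositional using (_∈_)
open import Relation.Binary.PropositionalEquality using (refl)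
open DNFProperties using (minimal⇒falsifiable; minimal⇒satisfiable; length≤maxWidth; falsifiable⇒terms-nonempty)
open DisjointTerms using (greedy; greedy⁺; greedy-disjoint; greedy-size)
open Restriction using (disjoint-terms≤200deg²)

lemma13 : Σ ℕ λ C → (n k : ℕ) (F : DNF n) → Minimal F → ReadK k F → 1 ≤ maxWidth F →
            (p : Poly n) → NApprox p (λ x → not (evalDNF F x)) →
            size F ≤ C * (degree p * degree p) * k * maxWidth F
lemma13 = 200 , bound
  where
  bound : (n k : ℕ) (F : DNF n) → Minimal F → ReadK k F → 1 ≤ maxWidth F →
          (p : Poly n) → NApprox p (λ x → not (evalDNF F x)) →
          size F ≤ 200 * (degree p * degree p) * k * maxWidth F
  bound n k F minimal read-k 1≤w p approx with minimal⇒falsifiable F minimal 1≤w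
  ... | x₀ , Fx₀≡false = begin
    length F          ≤⟨ greedy-size k w (length F) F ≤-refl read-k (falsifiable⇒terms-nonempty F x₀ Fx₀≡false) (length≤maxWidth F) ⟩
    w * k * length S  ≤⟨ *-monoʳ-≤ (w * k) (disjoint-terms≤200deg² F p approx x₀ Fx₀≡false S S⊆F
                           (All.map (minimal⇒satisfiable F minimal) S⊆F) (greedy-disjoint (length F) F)) ⟩
    w * k * (d * d * 200)
                      ≡⟨ solve 3 (λ w k d → w :* k :* (d :* d :* con 200) := con 200 :* (d :* d) :* k :* w) refl w k d ⟩
    200 * (d * d) * k * w ∎
    where
    open ≤-Reasoning
    open +-*-Solver
    w : ℕ
    w = maxWidth F
    d : ℕ
    d = degree p
    S : DNF n
    S = greedy (length F) F
    S⊆F : All (_∈ F) S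
    S⊆F = greedy⁺ (length F) (All.tabulate id)
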